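{- Let $n\ge1$, $R\le D_8$ with $r\in R$, and $T$ a set of tile designs for $R$. For $g\in R$ let $\mathrm{Fix}^{\mathrm{sq}}_g(n)=\sum_{(a,b)\in(\mathbb{Z}/n\mathbb{Z})^2}|X^{((a,b),g)}|$, where $X^{((a,b),g)}$ is the set of tilings of the $n\times n$ torus fixed by $((a,b),g)$. Then $$\mathrm{Fix}^{\mathrm{sq}}_{r}(n)=\mathrm{Fix}^{\mathrm{sq}}_{r^3}(n)=\begin{cases}n^2t_{\mathrm{id}}^{(n^2-1)/4}t_r & n\text{ odd},\\ n^2\left(\tfrac12 t_{\mathrm{id}}^{n^2/4}+\tfrac12 t_{\mathrm{id}}^{(n^2-4)/4}t_r^2t_{r^2}\right) & n\text{ even}.\end{cases}$$
   Context: Cells: $\mathbb{Z}/n\mathbb{Z}\times\mathbb{Z}/n\mathbb{Z}$. $D_8=\langle r,f\mid r^4=f^2=(rf)^2=\mathrm{id}\rangle$ acts on cells on the right, determined by $(x,y)\cdot f=(n-1-x,y)$ and $(x,y)\cdot r=(n-1-y,x)$ (so $r^3:(y,n-1-x)$). For $(a,b)\in(\mathbb{Z}/n\mathbb{Z})^2$ and $g\in R$, $(x,y)\cdot((a,b),g)=(x+a,y+b)\cdot g$. A set of tile designs for $R$ is a finite set $T$ with a right $R$-action; $t_g=|\{d\in T:d\cdot g=d\}|$. A tiling is a map $\tau$ from cells to $T$; $\tau$ is fixed by $s=((a,b),g)$ if $\tau(c\cdot s)=\tau(c)\cdot g$ for all cells $c$. -}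

module Defs where

open import Data.Nat using (ℕ; zero; suc; _+_; _*_; _∸_)
open import Data.Nat.DivMod using (_mod_)
open import Data.Bool using (Bool; true; false; not; T)
open import Data.Fin using (Fin; toℕ; opposite)
open import Data.Fin.Properties using (all?; _≟_)
open import Data.Product using (_×_; _,_)
open import Data.List using (List; []; _∷_; [_]; map; concatMap; allFin; filter; length)
open import Data.Nat.ListAction using (sum)
open import Data.Vec.Functional as VF using ()
open import Relation.Binary.PropositionalEquality using (_≡_)
open import Relation.Nullary using (Dec)

-- The dihedral group D8, elements in normal form r^i f^b (i ∈ Z/4, b ∈ {0,1}).
-- Relations r^4 = f^2 = (rf)^2 = id give f r^j = r^{-j} f, hence
--   (r^i f^a)(r^j f^b) = r^{i + (-1)^a j} f^{a+b}.

record D8 : Set where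
  constructor ⟨_,_⟩
  field
    rotPart  : Fin 4
    flipPart : Bool

mul : D8 → D8 → D8
mul ⟨ i , false ⟩ ⟨ j , b ⟩ = ⟨ (toℕ i + toℕ j) mod 4 , b ⟩
mul ⟨ i , true ⟩  ⟨ j , b ⟩ = ⟨ (toℕ i + (4 ∸ toℕ j)) mod 4 , not b ⟩

inv : D8 → D8
inv ⟨ i , false ⟩ = ⟨ (4 ∸ toℕ i) mod 4 , false ⟩
inv ⟨ i , true ⟩  = ⟨ i , true ⟩

e : D8
e = ⟨ Fin.zero , false ⟩

r : D8
r = ⟨ Fin.suc Fin.zero , false ⟩

f : D8
f = ⟨ Fin.zero , true ⟩

r² : D8
r² = mul r r

r³ : D8
r³ = mul r² r

-- Subgroups R ≤ D8 (membership given by a Boolean predicate, so that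
-- membership proofs are unique).

record Subgroup : Set where
  field
    inR      : D8 → Bool
    id∈      : T (inR e)
    mul∈     : ∀ {g h} → T (inR g) → T (inR h) → T (inR (mul g h))
    inv∈     : ∀ {g} → T (inR g) → T (inR (inv g))

record TileDesigns (R : Subgroup) : Set where
  open Subgroup R
  field
    k       : ℕ
    act     : Fin k → (g : D8) → T (inR g) → Fin k
    act-id  : ∀ d → act d e id∈ ≡ d
    act-mul : ∀ d {g h} (p : T (inR g)) (q : T (inR h)) →
              act (act d g p) h q ≡ act d (mul g h) (mul∈ p q)

tcount : {R : Subgroup} → TileDesigns R → (g : D8) → T (Subgroup.inR R g) → ℕ
tcount TD g p = length (filter (λ d → act d g p ≟ d) (allFin k))
  where open TileDesigns TD

Cell : ℕ → Set
Cell n = Fin n × Fin n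

addMod : {n : ℕ} → Fin n → Fin n → Fin n
addMod {suc m} x y = (toℕ x + toℕ y) mod (suc m)

cellF : {n : ℕ} → Cell n → Cell n
cellF (x , y) = (opposite x , y)

cellR : {n : ℕ} → Cell n → Cell n
cellR (x , y) = (opposite y , x)

rotIter : {n : ℕ} → ℕ → Cell n → Cell n
rotIter zero    c = c
rotIter (suc i) c = rotIter i (cellR c)

cellAct : {n : ℕ} → Cell n → D8 → Cell n
cellAct c ⟨ i , false ⟩ = rotIter (toℕ i) c
cellAct c ⟨ i , true ⟩  = cellF (rotIter (toℕ i) c)

cellActFull : {n : ℕ} → Cell n → Fin n → Fin n → D8 → Cell n
cellActFull (x , y) a b g = cellAct (addMod x a , addMod y b) g

Tiling : {R : Subgroup} → TileDesigns R → ℕ → Set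
Tiling TD n = Cell n → Fin (TileDesigns.k TD)

FixedBy : {R : Subgroup} (TD : TileDesigns R) {n : ℕ} →
          Fin n → Fin n → (g : D8) → T (Subgroup.inR R g) → Tiling TD n → Set
FixedBy TD a b g p τ =
  ∀ x y → τ (cellActFull (x , y) a b g) ≡ TileDesigns.act TD (τ (x , y)) g p

fixedBy? : {R : Subgroup} (TD : TileDesigns R) {n : ℕ} →
           (a b : Fin n) (g : D8) (p : T (Subgroup.inR R g)) (τ : Tiling TD n) →
           Dec (FixedBy TD a b g p τ)
fixedBy? TD a b g p τ =
  all? (λ x → all? (λ y → τ (cellActFull (x , y) a b g) ≟ TileDesigns.act TD (τ (x , y)) g p))

allFuns : {A : Set} → (m : ℕ) → List A → List (Fin m → A)
allFuns zero    xs = [ (λ ()) ]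
allFuns (suc m) xs = concatMap (λ a → map (λ g → a VF.∷ g) (allFuns m xs)) xs

allTilings : {R : Subgroup} (TD : TileDesigns R) (n : ℕ) → List (Tiling TD n)
allTilings TD n =
  map (λ φ c → φ (Data.Product.proj₁ c) (Data.Product.proj₂ c))
      (allFuns n (allFuns n (allFin (TileDesigns.k TD))))
  where import Data.Product

fixCount : {R : Subgroup} (TD : TileDesigns R) {n : ℕ} →
           Fin n → Fin n → (g : D8) → T (Subgroup.inR R g) → ℕ
fixCount TD {n} a b g p = length (filter (fixedBy? TD a b g p) (allTilings TD n))

FixSq : {R : Subgroup} (TD : TileDesigns R) (g : D8) → T (Subgroup.inR R g) → ℕ → ℕ
FixSq TD g p n = sum (map (λ a → sum (map (λ b → fixCount TD a b g p) (allFin n))) (allFin n))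

{-# OPTIONS --safe #-}
-- Fix a translation (a , b). The symmetry ((a , b) , r) permutes the cells by
-- σ (x , y) = (n - 1 - (y + b) , x + a), and σ⁴ = id; a tiling is fixed by it iff it intertwines σ with
-- the action A of r on the tile designs. Pick in every σ-orbit its first cell in row-major order. A fixed
-- tiling is then determined by its values at these representatives, and the value at a representative of
-- an orbit of size p can be any design with A^p v = v. Hence the number of fixed tilings is
-- t_r ^ F₁ * t_{r²} ^ ((F₂ - F₁) / 2) * t_id ^ ((n² - F₂) / 4), where F₁ and F₂ count the cells fixed by σ
-- and σ². Now σ² acts on the two coordinates by reflections z ↦ c - z of ℤ/n whose constants have the
-- same parity, so F₂ = F₁², and F₁ is the number of solutions of 2z ≡ n - 1 - a - b (mod n): one if n is
-- odd, and for even n two or none according as a + b is odd or even. The same count holds for r³ = r⁻¹,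
-- and summing over (a , b) gives the formula.
module Submission where

open import Defs
open import Data.Nat using (ℕ; _+_; _*_; _∸_; _^_; _≤_; _%_; _/_)
open import Data.Bool using (T)
open import Data.Product using (_×_)
open import Relation.Binary.PropositionalEquality using (_≡_)

open import Data.Nat using (zero; suc; _<_; s≤s; NonZero; _≡ᵇ_)
import Data.Nat as ℕ
open import Data.Nat.Properties
  using (+-*-semiring; *-1-commutativeMonoid; +-identityʳ; +-assoc; +-comm; +-cancelˡ-<; *-identityʳ; *-zeroʳ;
         *-assoc; *-comm; *-suc; *-distribʳ-+; *-cancelʳ-≡; ^-distribˡ-+-*; m+n∸m≡n; m∸n+n≡m; m+[n∸m]≡n;
         m<n⇒0<n∸m; m∸n≤m; n≢0⇒n>0; n≤0⇒n≡0; ≡ᵇ⇒≡; <⇒≤; ≮⇒≥; ≤∧≢⇒<; ≤-refl; ≤-trans; ≤-<-trans; ≤-antisym;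
         ≤-pred; <-cmp; <-asym)
open import Data.Nat.DivMod
  using (m≡m%n+[m/n]*n; m%n<n; m<n⇒m%n≡m; m%n%n≡m%n; %-distribˡ-+; %-distribˡ-*; [m+kn]%n≡m%n; m*n%n≡0;
         m*n/n≡m; m%n*o≡m*o%[n*o]; m∣n⇒o%n%m≡o%m)
open import Data.Nat.Divisibility using (divides)
open import Data.Nat.Solver using (module +-*-Solver)
import Data.Nat.ListAction as ListSum
open import Data.Bool using (Bool; true; false; _∧_; if_then_else_)
open import Data.Bool.Properties using (T-∧; T-irrelevant)
open import Data.Fin using (Fin; toℕ; fromℕ<; combine; opposite; _↑ˡ_; _↑ʳ_) renaming (zero to fzero; suc to fsuc)
import Data.Fin as Fin
open import Data.Fin.Properties
  using (_≟_; toℕ-injective; toℕ-fromℕ<; toℕ<n; toℕ-↑ˡ; toℕ-↑ʳ; combine-injective; combine-monoˡ-<; toℕ-combine;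
         opposite-prop; opposite-involutive)
open import Data.List using (List; []; _∷_; _++_; map; concatMap; tabulate; filter; length; allFin)
open import Data.Product using (_,_; proj₁; proj₂; ∃; uncurry)
open import Data.Product.Properties using (,-injective)
open import Data.Sum using (_⊎_; inj₁; inj₂)
open import Data.Unit using (tt)
open import Data.Empty using (⊥-elim)
open import Data.Vec.Functional using () renaming (_∷_ to _◂_)
open import Function using (_∘_; id; _⇔_; mk⇔; Equivalence)
open import Relation.Binary.PropositionalEquality
  using (refl; sym; trans; cong; cong₂; subst; subst₂; _≢_; module ≡-Reasoning)
open import Relation.Binary.Definitions using (DecidableEquality; tri<; tri≈; tri>)
open import Relation.Nullary using (Dec; does; yes; no; ¬_; contradiction)
open import Relation.Nullary.Decidable using (does-⇔; dec-true; dec-false; T?; map′; _×-dec_)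
open import Algebra.Properties.Semiring.Sum +-*-semiring
  using (sum; sum-syntax; sum-cong-≗; ∑-comm; ∑-distrib-+; *-distribˡ-sum; *-distribʳ-sum)
open import Algebra.Properties.CommutativeMonoid.Sum *-1-commutativeMonoid
  using () renaming (sum to ∏; sum-cong-≗ to ∏-cong; ∑-distrib-+ to ∏-distrib-*)
open +-*-Solver using (solve; _:+_; _:*_; _:=_; con)

⟦_⟧ : Bool → ℕ
⟦ true  ⟧ = 1
⟦ false ⟧ = 0

⟦∧⟧ : ∀ a b → ⟦ a ∧ b ⟧ ≡ ⟦ a ⟧ * ⟦ b ⟧
⟦∧⟧ true  b = sym (+-identityʳ ⟦ b ⟧)
⟦∧⟧ false b = refl

T-does⇒ : ∀ {P : Set} (P? : Dec P) → T (does P?) → P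
T-does⇒ (yes p) _ = p

T-does⇐ : ∀ {P : Set} (P? : Dec P) → P → T (does P?)
T-does⇐ (yes _) _ = _
T-does⇐ (no ¬p) p = ¬p p

sum-const : ∀ n c → ∑[ i < n ] c ≡ n * c
sum-const zero    c = refl
sum-const (suc n) c = cong (c +_) (sum-const n c)

∑-δ : ∀ {n} (j : Fin n) (f : Fin n → ℕ) → ∑[ i < n ] (⟦ does (j ≟ i) ⟧ * f i) ≡ f j
∑-δ {suc n} fzero f = begin
  (f fzero + 0) + ∑[ i < n ] 0  ≡⟨ cong₂ _+_ (+-identityʳ (f fzero)) (trans (sum-const n 0) (*-zeroʳ n)) ⟩
  f fzero + 0                   ≡⟨ +-identityʳ (f fzero) ⟩
  f fzero                       ∎
  where open ≡-Reasoning
∑-δ (fsuc j) f = ∑-δ j (f ∘ fsuc)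

∏-^ : ∀ {n} a (e : Fin n → ℕ) → ∏ (λ i → a ^ e i) ≡ a ^ ∑[ i < n ] e i
∏-^ {zero}  a e = refl
∏-^ {suc n} a e = trans (cong (a ^ e fzero *_) (∏-^ a (e ∘ fsuc)))
                        (sym (^-distribˡ-+-* a (e fzero) _))

count : ∀ {n} → (Fin n → Bool) → ℕ
count {n} p = ∑[ i < n ] ⟦ p i ⟧

count-cong : ∀ {n} {p q : Fin n → Bool} → (∀ i → p i ≡ q i) → count p ≡ count q
count-cong p≗q = sum-cong-≗ (cong ⟦_⟧ ∘ p≗q)

count-true : ∀ n → count {n} (λ _ → true) ≡ n
count-true n = trans (sum-const n 1) (*-identityʳ n)

count-false : ∀ n → count {n} (λ _ → false) ≡ 0
count-false n = trans (sum-const n 0) (*-zeroʳ n)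

count-≟ : ∀ {n} (j : Fin n) → count (λ i → does (j ≟ i)) ≡ 1
count-≟ {n} j = trans (sum-cong-≗ {n} (λ i → sym (*-identityʳ _))) (∑-δ j (λ _ → 1))

count-unique : ∀ {n} {P : Fin n → Set} {Q : Set} (P? : ∀ i → Dec (P i)) (Q? : Dec Q) →
               (Q → ∃ P) → (∀ i → P i → Q) → (∀ i j → P i → P j → i ≡ j) → count (does ∘ P?) ≡ ⟦ does Q? ⟧
count-unique {n} P? (no ¬q) _ sound _ = trans (count-cong λ i → dec-false (P? i) (¬q ∘ sound i)) (count-false n)
count-unique P? (yes q) complete _ unique with complete q
... | i₀ , pi₀ = trans (count-cong λ i → does-⇔ (mk⇔ (λ pi → unique i₀ i pi₀ pi) (λ { refl → pi₀ })) (P? i) (i₀ ≟ i))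
                       (count-≟ i₀)

countᴸ : {A : Set} → (A → Bool) → List A → ℕ
countᴸ p []       = 0
countᴸ p (x ∷ xs) = ⟦ p x ⟧ + countᴸ p xs

module _ {A : Set} where

  countᴸ-cong : ∀ {p q : A → Bool} xs → (∀ x → p x ≡ q x) → countᴸ p xs ≡ countᴸ q xs
  countᴸ-cong []       p≗q = refl
  countᴸ-cong (x ∷ xs) p≗q = cong₂ _+_ (cong ⟦_⟧ (p≗q x)) (countᴸ-cong xs p≗q)

  countᴸ-++ : ∀ (p : A → Bool) xs ys → countᴸ p (xs ++ ys) ≡ countᴸ p xs + countᴸ p ys
  countᴸ-++ p []       ys = refl
  countᴸ-++ p (x ∷ xs) ys = trans (cong (⟦ p x ⟧ +_) (countᴸ-++ p xs ys)) (sym (+-assoc ⟦ p x ⟧ _ _))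

  countᴸ-map : ∀ {B : Set} (p : B → Bool) (f : A → B) xs → countᴸ p (map f xs) ≡ countᴸ (p ∘ f) xs
  countᴸ-map p f []       = refl
  countᴸ-map p f (x ∷ xs) = cong (⟦ p (f x) ⟧ +_) (countᴸ-map p f xs)

  countᴸ-∧ : ∀ b (p : A → Bool) xs → countᴸ (λ x → b ∧ p x) xs ≡ ⟦ b ⟧ * countᴸ p xs
  countᴸ-∧ true  p xs = sym (+-identityʳ (countᴸ p xs))
  countᴸ-∧ false p []       = refl
  countᴸ-∧ false p (x ∷ xs) = countᴸ-∧ false p xs

  length-filter : ∀ {P : A → Set} (P? : ∀ x → Dec (P x)) xs → length (filter P? xs) ≡ countᴸ (does ∘ P?) xs
  length-filter P? []       = refl
  length-filter P? (x ∷ xs) with does (P? x)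
  ... | true  = cong suc (length-filter P? xs)
  ... | false = length-filter P? xs

countᴸ-tabulate : ∀ {A : Set} {n} (p : A → Bool) (f : Fin n → A) → countᴸ p (tabulate f) ≡ count (p ∘ f)
countᴸ-tabulate {n = zero}  p f = refl
countᴸ-tabulate {n = suc n} p f = cong (⟦ p (f fzero) ⟧ +_) (countᴸ-tabulate p (f ∘ fsuc))

sum-map-tabulate : ∀ {A : Set} {n} (f : A → ℕ) (g : Fin n → A) → ListSum.sum (map f (tabulate g)) ≡ ∑[ i < n ] f (g i)
sum-map-tabulate {n = zero}  f g = refl
sum-map-tabulate {n = suc n} f g = cong (f (g fzero) +_) (sum-map-tabulate f (g ∘ fsuc))

allᵇ : ∀ {n} → (Fin n → Bool) → Bool
allᵇ {zero}  p = true
allᵇ {suc n} p = p fzero ∧ allᵇ (p ∘ fsuc)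

T-allᵇ : ∀ {n} (p : Fin n → Bool) → T (allᵇ p) ⇔ (∀ i → T (p i))
T-allᵇ {zero}  p = mk⇔ (λ _ ()) _
T-allᵇ {suc n} p = mk⇔ to from
  where
  to : T (allᵇ p) → ∀ i → T (p i)
  to t fzero    = proj₁ (Equivalence.to T-∧ t)
  to t (fsuc i) = Equivalence.to (T-allᵇ (p ∘ fsuc)) (proj₂ (Equivalence.to (T-∧ {p fzero}) t)) i
  from : (∀ i → T (p i)) → T (allᵇ p)
  from h = Equivalence.from T-∧ (h fzero , Equivalence.from (T-allᵇ (p ∘ fsuc)) (h ∘ fsuc))

allᵇ-cong : ∀ {n} {p q : Fin n → Bool} → (∀ i → p i ≡ q i) → allᵇ p ≡ allᵇ q
allᵇ-cong {zero}  p≗q = refl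
allᵇ-cong {suc n} p≗q = cong₂ _∧_ (p≗q fzero) (allᵇ-cong (p≗q ∘ fsuc))

-- x₀ only supplies the (irrelevant) earlier values when Q is evaluated at the first position.
module CausalChoice {X : Set} (xs : List X) (x₀ : X) where

  Causal : ∀ {N} → (Fin N → (Fin N → X) → X → Bool) → Set
  Causal {N} Q = ∀ i g g' → (∀ j → j Fin.< i → g j ≡ g' j) → ∀ v → Q i g v ≡ Q i g' v

  countᴸ-causal : ∀ N (Q : Fin N → (Fin N → X) → X → Bool) (m : Fin N → ℕ) → Causal Q →
                  (∀ i g → countᴸ (Q i g) xs ≡ m i) →
                  countᴸ (λ g → allᵇ (λ i → Q i g (g i))) (allFuns N xs) ≡ ∏ m
  countᴸ-causal zero    Q m causal counts = refl
  countᴸ-causal (suc N) Q m causal counts = begin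
    countᴸ valid (allFuns (suc N) xs)  ≡⟨ blocks xs ⟩
    countᴸ first xs * ∏ (m ∘ fsuc)     ≡⟨ cong (_* ∏ (m ∘ fsuc)) (counts fzero (λ _ → x₀)) ⟩
    m fzero * ∏ (m ∘ fsuc)             ∎
    where
    open ≡-Reasoning
    tails : List (Fin N → X)
    tails = allFuns N xs
    valid : (Fin (suc N) → X) → Bool
    valid g = allᵇ (λ i → Q i g (g i))
    first : X → Bool
    first = Q fzero (λ _ → x₀)
    rest : X → (Fin N → X) → Bool
    rest a g = allᵇ (λ i → Q (fsuc i) (a ◂ g) (g i))

    rest-count : ∀ a → countᴸ (rest a) tails ≡ ∏ (m ∘ fsuc)
    rest-count a = countᴸ-causal N (λ i g → Q (fsuc i) (a ◂ g)) (m ∘ fsuc)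
      (λ i g g' agree → causal (fsuc i) (a ◂ g) (a ◂ g') λ { fzero _ → refl ; (fsuc j) (s≤s j<i) → agree j j<i })
      (λ i g → counts (fsuc i) (a ◂ g))

    block : ∀ a → countᴸ valid (map (a ◂_) tails) ≡ ⟦ first a ⟧ * ∏ (m ∘ fsuc)
    block a = begin
      countᴸ valid (map (a ◂_) tails)      ≡⟨ countᴸ-map valid (a ◂_) tails ⟩
      countᴸ (valid ∘ (a ◂_)) tails        ≡⟨ countᴸ-cong tails (λ g → cong (_∧ rest a g)
                                                (causal fzero (a ◂ g) (λ _ → x₀) (λ _ ()) a)) ⟩
      countᴸ (λ g → first a ∧ rest a g) tails ≡⟨ countᴸ-∧ (first a) (rest a) tails ⟩
      ⟦ first a ⟧ * countᴸ (rest a) tails  ≡⟨ cong (⟦ first a ⟧ *_) (rest-count a) ⟩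
      ⟦ first a ⟧ * ∏ (m ∘ fsuc)           ∎

    blocks : ∀ ys → countᴸ valid (concatMap (λ a → map (a ◂_) tails) ys) ≡ countᴸ first ys * ∏ (m ∘ fsuc)
    blocks []       = refl
    blocks (a ∷ ys) = begin
      countᴸ valid (map (a ◂_) tails ++ concatMap (λ a → map (a ◂_) tails) ys)
        ≡⟨ countᴸ-++ valid (map (a ◂_) tails) (concatMap (λ a → map (a ◂_) tails) ys) ⟩
      countᴸ valid (map (a ◂_) tails) + countᴸ valid (concatMap (λ a → map (a ◂_) tails) ys)
        ≡⟨ cong₂ _+_ (block a) (blocks ys) ⟩
      ⟦ first a ⟧ * ∏ (m ∘ fsuc) + countᴸ first ys * ∏ (m ∘ fsuc)
        ≡⟨ *-distribʳ-+ (∏ (m ∘ fsuc)) ⟦ first a ⟧ (countᴸ first ys) ⟨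
      countᴸ first (a ∷ ys) * ∏ (m ∘ fsuc) ∎

-- The position of a cell in the row-major order in which allFuns n (allFuns n _) lists the tilings.
rank : ∀ {n} → Cell n → Fin (n * n)
rank (x , y) = combine x y

rank-injective : ∀ {n} {c c' : Cell n} → rank c ≡ rank c' → c ≡ c'
rank-injective {c = x , y} {x' , y'} eq with combine-injective x y x' y' eq
... | refl , refl = refl

rank-<-row : ∀ {n} {x y x' y' : Fin n} → rank (x' , y') Fin.< rank (x , y) → x' ≢ x → x' Fin.< x
rank-<-row {x = x} {y} {x'} {y'} lt x'≢x with <-cmp (toℕ x') (toℕ x)
... | tri< x'<x _ _ = x'<x
... | tri≈ _ x'≡x _ = ⊥-elim (x'≢x (toℕ-injective x'≡x))
... | tri> _ _ x<x' = ⊥-elim (<-asym lt (combine-monoˡ-< y y' x<x'))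

rank-<-col : ∀ {n} {x y y' : Fin n} → rank (x , y') Fin.< rank (x , y) → y' Fin.< y
rank-<-col {n} {x} {y} {y'} lt =
  +-cancelˡ-< (n * toℕ x) (toℕ y') (toℕ y) (subst₂ _<_ (toℕ-combine x y') (toℕ-combine x y) lt)

infix 4 _≟ᶜ_

-- Opaque, so that `with σ c ≟ᶜ c` can abstract the tests made inside period and similar definitions.
opaque
  _≟ᶜ_ : ∀ {n} → DecidableEquality (Cell n)
  (x , y) ≟ᶜ (x' , y') = map′ (λ (p , q) → cong₂ _,_ p q) ,-injective (x ≟ x' ×-dec y ≟ y')

∑ᶜ : ∀ {n} → (Cell n → ℕ) → ℕ
∑ᶜ {n} f = ∑[ x < n ] ∑[ y < n ] f (x , y)

countᶜ : ∀ {n} → (Cell n → Bool) → ℕ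
countᶜ p = ∑ᶜ (⟦_⟧ ∘ p)

∏ᶜ : ∀ {n} → (Cell n → ℕ) → ℕ
∏ᶜ f = ∏ (λ x → ∏ (λ y → f (x , y)))

allᶜ : ∀ {n} → (Cell n → Bool) → Bool
allᶜ p = allᵇ (λ x → allᵇ (λ y → p (x , y)))

T-allᶜ : ∀ {n} (p : Cell n → Bool) → T (allᶜ p) ⇔ (∀ c → T (p c))
T-allᶜ p = mk⇔ (λ ok (x , y) → Equivalence.to (T-allᵇ _) (Equivalence.to (T-allᵇ _) ok x) y)
               (λ ok → Equivalence.from (T-allᵇ _) λ x → Equivalence.from (T-allᵇ _) λ y → ok (x , y))

module _ {n : ℕ} where

  ∑ᶜ-cong : {f g : Cell n → ℕ} → (∀ c → f c ≡ g c) → ∑ᶜ f ≡ ∑ᶜ g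
  ∑ᶜ-cong f≗g = sum-cong-≗ λ x → sum-cong-≗ λ y → f≗g (x , y)

  *-distribˡ-∑ᶜ : ∀ a (f : Cell n → ℕ) → a * ∑ᶜ f ≡ ∑ᶜ (λ c → a * f c)
  *-distribˡ-∑ᶜ a f = trans (*-distribˡ-sum a (λ x → ∑[ y < n ] f (x , y))) (sum-cong-≗ λ x → *-distribˡ-sum a (λ y → f (x , y)))

  ∑ᶜ-comm : (f : Cell n → Cell n → ℕ) → ∑ᶜ (λ c → ∑ᶜ (f c)) ≡ ∑ᶜ (λ d → ∑ᶜ (λ c → f c d))
  ∑ᶜ-comm f = begin
    ∑[ x < n ] ∑[ y < n ] ∑[ x' < n ] ∑[ y' < n ] f (x , y) (x' , y')
      ≡⟨ sum-cong-≗ (λ x → ∑-comm λ y x' → ∑[ y' < n ] f (x , y) (x' , y')) ⟩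
    ∑[ x < n ] ∑[ x' < n ] ∑[ y < n ] ∑[ y' < n ] f (x , y) (x' , y')
      ≡⟨ ∑-comm (λ x x' → ∑[ y < n ] ∑[ y' < n ] f (x , y) (x' , y')) ⟩
    ∑[ x' < n ] ∑[ x < n ] ∑[ y < n ] ∑[ y' < n ] f (x , y) (x' , y')
      ≡⟨ sum-cong-≗ (λ x' → sum-cong-≗ λ x → ∑-comm λ y y' → f (x , y) (x' , y')) ⟩
    ∑[ x' < n ] ∑[ x < n ] ∑[ y' < n ] ∑[ y < n ] f (x , y) (x' , y')
      ≡⟨ sum-cong-≗ (λ x' → ∑-comm λ x y' → ∑[ y < n ] f (x , y) (x' , y')) ⟩
    ∑[ x' < n ] ∑[ y' < n ] ∑[ x < n ] ∑[ y < n ] f (x , y) (x' , y') ∎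
    where open ≡-Reasoning

  ∑ᶜ-distrib-+ : (f g : Cell n → ℕ) → ∑ᶜ (λ c → f c + g c) ≡ ∑ᶜ f + ∑ᶜ g
  ∑ᶜ-distrib-+ f g = trans (sum-cong-≗ {n} λ x → ∑-distrib-+ (λ y → f (x , y)) (λ y → g (x , y)))
                           (∑-distrib-+ (λ x → ∑[ y < n ] f (x , y)) (λ x → ∑[ y < n ] g (x , y)))

  ∑ᶜ-∑-comm : ∀ {m} (f : Cell n → Fin m → ℕ) → ∑ᶜ (λ c → ∑[ i < m ] f c i) ≡ ∑[ i < m ] ∑ᶜ (λ c → f c i)
  ∑ᶜ-∑-comm f = trans (sum-cong-≗ λ x → ∑-comm λ y i → f (x , y) i) (∑-comm λ x i → ∑[ y < n ] f (x , y) i)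

  ∑ᶜ-const : ∀ a → ∑ᶜ {n} (λ _ → a) ≡ n * (n * a)
  ∑ᶜ-const a = trans (sum-cong-≗ {n} (λ _ → sum-const n a)) (sum-const n (n * a))

  ∑ᶜ-δ : ∀ (u : Cell n) (f : Cell n → ℕ) → ∑ᶜ (λ c → ⟦ does (u ≟ᶜ c) ⟧ * f c) ≡ f u
  ∑ᶜ-δ (u₁ , u₂) f = begin
    ∑ᶜ (λ c → ⟦ does ((u₁ , u₂) ≟ᶜ c) ⟧ * f c)
      ≡⟨ ∑ᶜ-cong (λ (x , y) → cong (λ b → ⟦ b ⟧ * f (x , y))
                   (does-⇔ (mk⇔ ,-injective (λ (p , q) → cong₂ _,_ p q)) ((u₁ , u₂) ≟ᶜ (x , y)) (u₁ ≟ x ×-dec u₂ ≟ y))) ⟩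
    ∑[ x < n ] ∑[ y < n ] (⟦ does (u₁ ≟ x) ∧ does (u₂ ≟ y) ⟧ * f (x , y))
      ≡⟨ sum-cong-≗ (λ x → sum-cong-≗ λ y → trans (cong (_* f (x , y)) (⟦∧⟧ (does (u₁ ≟ x)) (does (u₂ ≟ y))))
                                                  (*-assoc ⟦ does (u₁ ≟ x) ⟧ ⟦ does (u₂ ≟ y) ⟧ (f (x , y)))) ⟩
    ∑[ x < n ] ∑[ y < n ] (⟦ does (u₁ ≟ x) ⟧ * (⟦ does (u₂ ≟ y) ⟧ * f (x , y)))
      ≡⟨ sum-cong-≗ (λ x → sym (*-distribˡ-sum ⟦ does (u₁ ≟ x) ⟧ (λ y → ⟦ does (u₂ ≟ y) ⟧ * f (x , y)))) ⟩
    ∑[ x < n ] (⟦ does (u₁ ≟ x) ⟧ * ∑[ y < n ] (⟦ does (u₂ ≟ y) ⟧ * f (x , y)))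
      ≡⟨ sum-cong-≗ (λ x → cong (⟦ does (u₁ ≟ x) ⟧ *_) (∑-δ u₂ (λ y → f (x , y)))) ⟩
    ∑[ x < n ] (⟦ does (u₁ ≟ x) ⟧ * f (x , u₂))
      ≡⟨ ∑-δ u₁ (λ x → f (x , u₂)) ⟩
    f (u₁ , u₂) ∎
    where open ≡-Reasoning

  countᶜ-≟ : ∀ (u : Cell n) → countᶜ (λ c → does (u ≟ᶜ c)) ≡ 1
  countᶜ-≟ u = trans (∑ᶜ-cong λ c → sym (*-identityʳ _)) (∑ᶜ-δ u (λ _ → 1))

  ∏ᶜ-cong : {f g : Cell n → ℕ} → (∀ c → f c ≡ g c) → ∏ᶜ f ≡ ∏ᶜ g
  ∏ᶜ-cong f≗g = ∏-cong {n} λ x → ∏-cong {n} λ y → f≗g (x , y)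

  ∏ᶜ-distrib-* : (f g : Cell n → ℕ) → ∏ᶜ (λ c → f c * g c) ≡ ∏ᶜ f * ∏ᶜ g
  ∏ᶜ-distrib-* f g = trans (∏-cong {n} λ x → ∏-distrib-* (λ y → f (x , y)) (λ y → g (x , y)))
                           (∏-distrib-* (λ x → ∏ (λ y → f (x , y))) (λ x → ∏ (λ y → g (x , y))))

  ∏ᶜ-^ : ∀ a (e : Cell n → ℕ) → ∏ᶜ (λ c → a ^ e c) ≡ a ^ ∑ᶜ e
  ∏ᶜ-^ a e = trans (∏-cong {n} λ x → ∏-^ a (λ y → e (x , y))) (∏-^ a (λ x → ∑[ y < n ] e (x , y)))

Causalᶜ : ∀ {X : Set} {n} → (Cell n → (Cell n → X) → X → Bool) → Set
Causalᶜ Q = ∀ c τ τ' → (∀ c' → rank c' Fin.< rank c → τ c' ≡ τ' c') → ∀ v → Q c τ v ≡ Q c τ' v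

module CausalChoiceᶜ {X : Set} (xs : List X) (x₀ : X) (n : ℕ) where

  splice : (Fin n → Fin n → X) → Fin n → (Fin n → X) → Cell n → X
  splice G x row (x' , y') = if does (x' ≟ x) then row y' else G x' y'

  countᴸ-causalᶜ : (Q : Cell n → (Cell n → X) → X → Bool) (m : Cell n → ℕ) → Causalᶜ Q →
                   (∀ c τ → countᴸ (Q c τ) xs ≡ m c) →
                   countᴸ (λ φ → allᶜ (λ c → Q c (uncurry φ) (uncurry φ c))) (allFuns n (allFuns n xs)) ≡ ∏ᶜ m
  countᴸ-causalᶜ Q m causal counts = begin
    countᴸ (λ φ → allᶜ (λ c → Q c (uncurry φ) (uncurry φ c))) (allFuns n (allFuns n xs))
      ≡⟨ countᴸ-cong (allFuns n (allFuns n xs)) (λ φ → sym (rowwise φ)) ⟩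
    countᴸ (λ φ → allᵇ (λ x → rowOK x φ (φ x))) (allFuns n (allFuns n xs))
      ≡⟨ Rows.countᴸ-causal n rowOK (λ x → ∏ (λ y → m (x , y))) rowOK-causal rowOK-count ⟩
    ∏ᶜ m ∎
    where
    open ≡-Reasoning
    module Rows = CausalChoice (allFuns n xs) (λ _ → x₀)
    module Cells = CausalChoice xs x₀

    rowOK : Fin n → (Fin n → Fin n → X) → (Fin n → X) → Bool
    rowOK x G row = allᵇ (λ y → Q (x , y) (splice G x row) (row y))

    splice-self : ∀ φ x c → splice φ x (φ x) c ≡ uncurry φ c
    splice-self φ x (x' , y') with x' ≟ x
    ... | yes refl = refl
    ... | no _     = refl

    rowwise : ∀ φ → allᵇ (λ x → rowOK x φ (φ x)) ≡ allᶜ (λ c → Q c (uncurry φ) (uncurry φ c))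
    rowwise φ = allᵇ-cong λ x → allᵇ-cong λ y → causal (x , y) _ _ (λ c' _ → splice-self φ x c') (φ x y)

    rowOK-causal : Rows.Causal rowOK
    rowOK-causal x G G' agree row = allᵇ-cong λ y → causal (x , y) _ _ (earlier-rows y) (row y)
      where
      earlier-rows : ∀ y c' → rank c' Fin.< rank (x , y) → splice G x row c' ≡ splice G' x row c'
      earlier-rows y (x' , y') lt with x' ≟ x
      ... | yes _    = refl
      ... | no x'≢x = cong (λ r → r y') (agree x' (rank-<-row lt x'≢x))

    rowOK-count : ∀ x G → countᴸ (rowOK x G) (allFuns n xs) ≡ ∏ (λ y → m (x , y))
    rowOK-count x G = Cells.countᴸ-causal n (λ y row → Q (x , y) (splice G x row)) (λ y → m (x , y))
      (λ y row row' agree → causal (x , y) _ _ (earlier-cells y row row' agree))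
      (λ y row → counts (x , y) (splice G x row))
      where
      earlier-cells : ∀ y row row' → (∀ j → j Fin.< y → row j ≡ row' j) →
                      ∀ c' → rank c' Fin.< rank (x , y) → splice G x row c' ≡ splice G x row' c'
      earlier-cells y row row' agree (x' , y') lt with x' ≟ x
      ... | yes refl = agree y' (rank-<-col lt)
      ... | no _     = refl

infixr 9 _^[_]_

_^[_]_ : {X : Set} → (X → X) → ℕ → X → X
f ^[ zero  ] x = x
f ^[ suc i ] x = f (f ^[ i ] x)

module _ {X : Set} (f : X → X) where

  ^[+] : ∀ i j x → f ^[ i + j ] x ≡ f ^[ i ] (f ^[ j ] x)
  ^[+] zero    j x = refl
  ^[+] (suc i) j x = cong f (^[+] i j x)

  ^[*]-fixed : ∀ {p x} → f ^[ p ] x ≡ x → ∀ q → f ^[ q * p ] x ≡ x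
  ^[*]-fixed fx zero = refl
  ^[*]-fixed {p} {x} fx (suc q) = trans (^[+] p (q * p) x) (trans (cong (f ^[ p ]_) (^[*]-fixed fx q)) fx)

  ^[%] : ∀ {p x} .{{_ : NonZero p}} → f ^[ p ] x ≡ x → ∀ d → f ^[ d ] x ≡ f ^[ d % p ] x
  ^[%] {p} {x} fx d = begin
    f ^[ d ] x                         ≡⟨ cong (λ e → f ^[ e ] x) (m≡m%n+[m/n]*n d p) ⟩
    f ^[ d % p + d / p * p ] x         ≡⟨ ^[+] (d % p) (d / p * p) x ⟩
    f ^[ d % p ] (f ^[ d / p * p ] x)  ≡⟨ cong (f ^[ d % p ]_) (^[*]-fixed fx (d / p)) ⟩
    f ^[ d % p ] x                     ∎
    where open ≡-Reasoning

  ^[]-injective : (∀ {x y} → f x ≡ f y → x ≡ y) → ∀ i {x y} → f ^[ i ] x ≡ f ^[ i ] y → x ≡ y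
  ^[]-injective inj zero    eq = eq
  ^[]-injective inj (suc i) eq = ^[]-injective inj i (inj eq)

^[]-natural : ∀ {X Y : Set} {f : X → X} {g : Y → Y} (h : X → Y) → (∀ x → h (f x) ≡ g (h x)) →
              ∀ i x → h (f ^[ i ] x) ≡ g ^[ i ] (h x)
^[]-natural h commute zero    x = refl
^[]-natural {g = g} h commute (suc i) x = trans (commute _) (cong g (^[]-natural h commute i x))

exact-quotient : ∀ q .{{_ : NonZero q}} {a b c} → c ≡ a + q * b → (c ∸ a) / q ≡ b
exact-quotient q {a} {b} refl = trans (cong (_/ q) (trans (m+n∸m≡n a (q * b)) (*-comm q b))) (m*n/n≡m b q)

module Orbits {n : ℕ} (σ : Cell n → Cell n) (σ⁴ : ∀ c → σ ^[ 4 ] c ≡ c) where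

  σ-injective : ∀ {c d} → σ c ≡ σ d → c ≡ d
  σ-injective {c} {d} eq = trans (sym (σ⁴ c)) (trans (cong (σ ^[ 3 ]_) eq) (σ⁴ d))

  -- Opaque: everything below only uses rep-minimal and rep-orbit, and unfolding rep makes the goals huge.
  opaque
    infixl 5 _⊓_
    _⊓_ : Cell n → Cell n → Cell n
    c ⊓ d with rank d Fin.<? rank c
    ... | yes _ = d
    ... | no  _ = c

    ⊓-sel : ∀ c d → c ⊓ d ≡ c ⊎ c ⊓ d ≡ d
    ⊓-sel c d with rank d Fin.<? rank c
    ... | yes _ = inj₂ refl
    ... | no  _ = inj₁ refl

    ⊓-≤ˡ : ∀ c d → rank (c ⊓ d) Fin.≤ rank c
    ⊓-≤ˡ c d with rank d Fin.<? rank c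
    ... | yes d<c = <⇒≤ d<c
    ... | no  _   = ≤-refl

    ⊓-≤ʳ : ∀ c d → rank (c ⊓ d) Fin.≤ rank d
    ⊓-≤ʳ c d with rank d Fin.<? rank c
    ... | yes _   = ≤-refl
    ... | no  d≮c = ≮⇒≥ d≮c

    rep : Cell n → Cell n
    rep c = (c ⊓ σ c) ⊓ (σ ^[ 2 ] c ⊓ σ ^[ 3 ] c)

    rep-minimal : ∀ i c → rank (rep c) Fin.≤ rank (σ ^[ i ] c)
    rep-minimal 0 c = ≤-trans (⊓-≤ˡ _ _) (⊓-≤ˡ c (σ c))
    rep-minimal 1 c = ≤-trans (⊓-≤ˡ _ _) (⊓-≤ʳ c (σ c))
    rep-minimal 2 c = ≤-trans (⊓-≤ʳ _ _) (⊓-≤ˡ (σ ^[ 2 ] c) (σ ^[ 3 ] c))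
    rep-minimal 3 c = ≤-trans (⊓-≤ʳ _ _) (⊓-≤ʳ (σ ^[ 2 ] c) (σ ^[ 3 ] c))
    rep-minimal (suc (suc (suc (suc i)))) c =
      subst (λ z → rank (rep c) Fin.≤ rank z) (sym (σ⁴ (σ ^[ i ] c))) (rep-minimal i c)

    rep-orbit : ∀ c → ∃ λ i → σ ^[ i ] c ≡ rep c
    rep-orbit c with ⊓-sel (c ⊓ σ c) (σ ^[ 2 ] c ⊓ σ ^[ 3 ] c) | ⊓-sel c (σ c) | ⊓-sel (σ ^[ 2 ] c) (σ ^[ 3 ] c)
    ... | inj₁ eq | inj₁ eq′ | _        = 0 , sym (trans eq eq′)
    ... | inj₁ eq | inj₂ eq′ | _        = 1 , sym (trans eq eq′)
    ... | inj₂ eq | _        | inj₁ eq′ = 2 , sym (trans eq eq′)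
    ... | inj₂ eq | _        | inj₂ eq′ = 3 , sym (trans eq eq′)

  σ^multiple-of-4 : ∀ q c → σ ^[ q * 4 ] c ≡ c
  σ^multiple-of-4 q c = ^[*]-fixed σ (σ⁴ c) q

  rep-σ : ∀ c → rep (σ c) ≡ rep c
  rep-σ c with rep-orbit c | rep-orbit (σ c)
  ... | i , σⁱc≡rep | j , σʲσc≡rep = rank-injective (toℕ-injective (≤-antisym rep-σc≤rep rep≤rep-σc))
    where
    rep-σc≤rep : rank (rep (σ c)) Fin.≤ rank (rep c)
    rep-σc≤rep = subst (λ z → rank (rep (σ c)) Fin.≤ rank z)
                       (trans (trans (^[+] σ i 3 (σ c)) (cong (σ ^[ i ]_) (σ⁴ c))) σⁱc≡rep)
                       (rep-minimal (i + 3) (σ c))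
    rep≤rep-σc : rank (rep c) Fin.≤ rank (rep (σ c))
    rep≤rep-σc = subst (λ z → rank (rep c) Fin.≤ rank z) (trans (^[+] σ j 1 c) σʲσc≡rep) (rep-minimal (j + 1) c)

  rep-^ : ∀ i c → rep (σ ^[ i ] c) ≡ rep c
  rep-^ zero    c = refl
  rep-^ (suc i) c = trans (rep-σ (σ ^[ i ] c)) (rep-^ i c)

  rep-idem : ∀ c → rep (rep c) ≡ rep c
  rep-idem c with rep-orbit c
  ... | i , σⁱc≡rep = trans (cong rep (sym σⁱc≡rep)) (rep-^ i c)

  rep-least : ∀ c → toℕ (rank c) ≡ 0 → rep c ≡ c
  rep-least c rank≡0 = rank-injective (toℕ-injective (trans rank-rep≡0 (sym rank≡0)))
    where
    rank-rep≡0 : toℕ (rank (rep c)) ≡ 0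
    rank-rep≡0 = n≤0⇒n≡0 (subst (toℕ (rank (rep c)) ≤_) rank≡0 (rep-minimal 0 c))

  rep-< : ∀ c → rep c ≢ c → rank (rep c) Fin.< rank c
  rep-< c rep≢c = ≤∧≢⇒< (rep-minimal 0 c) (rep≢c ∘ rank-injective ∘ toℕ-injective)

  -- If σ ^[ i ] c ≡ rep c then σ ^[ i * 3 ] (rep c) ≡ σ ^[ i * 4 ] c ≡ c.
  offset : Cell n → ℕ
  offset c = proj₁ (rep-orbit c) * 3

  σ^offset : ∀ c → σ ^[ offset c ] (rep c) ≡ c
  σ^offset c with rep-orbit c
  ... | i , σⁱc≡rep = begin
    σ ^[ i * 3 ] (rep c)            ≡⟨ cong (σ ^[ i * 3 ]_) σⁱc≡rep ⟨
    σ ^[ i * 3 ] (σ ^[ i ] c)       ≡⟨ ^[+] σ (i * 3) i c ⟨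
    σ ^[ i * 3 + i ] c              ≡⟨ cong (λ e → σ ^[ e ] c) (trans (+-comm (i * 3) i) (sym (*-suc i 3))) ⟩
    σ ^[ i * 4 ] c                  ≡⟨ σ^multiple-of-4 i c ⟩
    c                               ∎
    where open ≡-Reasoning

  isRep : Cell n → Bool
  isRep c = does (rep c ≟ᶜ c)

  period : Cell n → ℕ
  period c = if does (σ c ≟ᶜ c) then 1 else if does (σ (σ c) ≟ᶜ c) then 2 else 4

  instance
    period-nonZero : ∀ {c} → NonZero (period c)
    period-nonZero {c} with σ c ≟ᶜ c | σ (σ c) ≟ᶜ c
    ... | yes _ | _     = _
    ... | no  _ | yes _ = _
    ... | no  _ | no  _ = _

  σ^period : ∀ c → σ ^[ period c ] c ≡ c
  σ^period c with σ c ≟ᶜ c | σ (σ c) ≟ᶜ c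
  ... | yes σc≡c | _       = σc≡c
  ... | no  _    | yes σ²c≡c = σ²c≡c
  ... | no  _    | no  _     = σ⁴ c

  period-minimal : ∀ c d → 0 < d → d < period c → σ ^[ d ] c ≢ c
  period-minimal c d 0<d d<p with σ c ≟ᶜ c | σ (σ c) ≟ᶜ c
  period-minimal c 1 _ _ | no σc≢c | _ = σc≢c
  period-minimal c 2 _ _ | no _ | no σ²c≢c = σ²c≢c
  period-minimal c 3 _ _ | no _ | no σ²c≢c = λ σ³c≡c → σ²c≢c (trans (σ-injective (trans σ³c≡c (sym (σ⁴ c)))) σ³c≡c)
  period-minimal c (suc (suc zero)) _ (s≤s (s≤s ())) | no _ | yes _
  period-minimal c (suc (suc (suc (suc _)))) _ (s≤s (s≤s (s≤s (s≤s ())))) | no _ | no _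
  period-minimal c (suc _) _ (s≤s ()) | yes _ | _

  period-σ : ∀ c → period (σ c) ≡ period c
  period-σ c = cong₂ (λ fixed₁ fixed₂ → if fixed₁ then 1 else if fixed₂ then 2 else 4)
                     (does-⇔ (mk⇔ σ-injective (cong σ)) (σ (σ c) ≟ᶜ σ c) (σ c ≟ᶜ c))
                     (does-⇔ (mk⇔ σ-injective (cong σ)) (σ (σ (σ c)) ≟ᶜ σ c) (σ (σ c) ≟ᶜ c))

  period-^ : ∀ i c → period (σ ^[ i ] c) ≡ period c
  period-^ zero    c = refl
  period-^ (suc i) c = trans (period-σ (σ ^[ i ] c)) (period-^ i c)

  period-rep : ∀ c → period (rep c) ≡ period c
  period-rep c with rep-orbit c
  ... | i , σⁱc≡rep = trans (cong period (sym σⁱc≡rep)) (period-^ i c)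

  period-∣ : ∀ c d → σ ^[ d ] c ≡ c → d % period c ≡ 0
  period-∣ c d σᵈc≡c with d % period c ℕ.≟ 0
  ... | yes r≡0 = r≡0
  ... | no  r≢0 = ⊥-elim (period-minimal c (d % period c) (n≢0⇒n>0 r≢0) (m%n<n d (period c))
                                         (trans (sym (^[%] σ (σ^period c) d)) σᵈc≡c))

  σ^-no-return : ∀ c {i j} → i < j → j < period c → σ ^[ i ] c ≢ σ ^[ j ] c
  σ^-no-return c {i} {j} i<j j<p σⁱc≡σʲc =
    period-minimal c (j ∸ i) (m<n⇒0<n∸m i<j) (≤-<-trans (m∸n≤m j i) j<p)
      (^[]-injective σ σ-injective i (sym (begin
        σ ^[ i ] c                    ≡⟨ σⁱc≡σʲc ⟩
        σ ^[ j ] c                    ≡⟨ cong (λ e → σ ^[ e ] c) (m+[n∸m]≡n (<⇒≤ i<j)) ⟨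
        σ ^[ i + (j ∸ i) ] c          ≡⟨ ^[+] σ i (j ∸ i) c ⟩
        σ ^[ i ] (σ ^[ j ∸ i ] c)     ∎)))
    where open ≡-Reasoning

  σ^-injective-below-period : ∀ c {i j} → i < period c → j < period c → σ ^[ i ] c ≡ σ ^[ j ] c → i ≡ j
  σ^-injective-below-period c {i} {j} i<p j<p eq with <-cmp i j
  ... | tri< i<j _ _ = ⊥-elim (σ^-no-return c i<j j<p eq)
  ... | tri≈ _ i≡j _ = i≡j
  ... | tri> _ _ j<i = ⊥-elim (σ^-no-return c j<i i<p (sym eq))

  orbit-size : ∀ s → rep s ≡ s → ∑ᶜ (λ c → ⟦ does (rep c ≟ᶜ s) ⟧) ≡ period s
  orbit-size s rep-s = begin
    ∑ᶜ (λ c → ⟦ does (rep c ≟ᶜ s) ⟧)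
      ≡⟨ ∑ᶜ-cong (λ c → sym (orbit-indicator c)) ⟩
    ∑ᶜ (λ c → count {period s} (λ i → does (σ ^[ toℕ i ] s ≟ᶜ c)))
      ≡⟨ ∑ᶜ-∑-comm {m = period s} (λ c i → ⟦ does (σ ^[ toℕ i ] s ≟ᶜ c) ⟧) ⟩
    ∑[ i < period s ] countᶜ (λ c → does (σ ^[ toℕ i ] s ≟ᶜ c))
      ≡⟨ sum-cong-≗ {period s} (λ i → countᶜ-≟ (σ ^[ toℕ i ] s)) ⟩
    count {period s} (λ _ → true)
      ≡⟨ count-true (period s) ⟩
    period s ∎
    where
    open ≡-Reasoning
    orbit-indicator : ∀ c → count {period s} (λ i → does (σ ^[ toℕ i ] s ≟ᶜ c)) ≡ ⟦ does (rep c ≟ᶜ s) ⟧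
    orbit-indicator c = count-unique (λ i → σ ^[ toℕ i ] s ≟ᶜ c) (rep c ≟ᶜ s) complete sound unique
      where
      complete : rep c ≡ s → ∃ λ i → σ ^[ toℕ i ] s ≡ c
      complete rep-c = fromℕ< r<p , (begin
        σ ^[ toℕ (fromℕ< r<p) ] s                            ≡⟨ cong (λ e → σ ^[ e ] s) (toℕ-fromℕ< r<p) ⟩
        σ ^[ offset c % period s ] s                         ≡⟨ ^[%] σ (σ^period s) (offset c) ⟨
        σ ^[ offset c ] s                                    ≡⟨ cong (σ ^[ offset c ]_) rep-c ⟨
        σ ^[ offset c ] (rep c)                              ≡⟨ σ^offset c ⟩
        c                                                    ∎)
        where
        r<p : offset c % period s < period s
        r<p = m%n<n (offset c) (period s)
      sound : ∀ i → σ ^[ toℕ i ] s ≡ c → rep c ≡ s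
      sound i eq = trans (cong rep (sym eq)) (trans (rep-^ (toℕ i) s) rep-s)
      unique : ∀ i j → σ ^[ toℕ i ] s ≡ c → σ ^[ toℕ j ] s ≡ c → i ≡ j
      unique i j eqᵢ eqⱼ = toℕ-injective (σ^-injective-below-period s (toℕ<n i) (toℕ<n j) (trans eqᵢ (sym eqⱼ)))

  orbitsOfSize : ℕ → ℕ
  orbitsOfSize q = countᶜ (λ s → isRep s ∧ (period s ≡ᵇ q))

  cells-of-period : ∀ q → countᶜ (λ c → period c ≡ᵇ q) ≡ q * orbitsOfSize q
  cells-of-period q = begin
    countᶜ (λ c → period c ≡ᵇ q)
      ≡⟨ ∑ᶜ-cong (λ c → sym (trans (∑ᶜ-δ (rep c) (⟦_⟧ ∘ onOrbit)) (cong ⟦_⟧ (onOrbit-rep c)))) ⟩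
    ∑ᶜ (λ c → ∑ᶜ (λ s → ⟦ does (rep c ≟ᶜ s) ⟧ * ⟦ onOrbit s ⟧))
      ≡⟨ ∑ᶜ-comm (λ c s → ⟦ does (rep c ≟ᶜ s) ⟧ * ⟦ onOrbit s ⟧) ⟩
    ∑ᶜ (λ s → ∑ᶜ (λ c → ⟦ does (rep c ≟ᶜ s) ⟧ * ⟦ onOrbit s ⟧))
      ≡⟨ ∑ᶜ-cong (λ s → trans (∑ᶜ-cong λ c → *-comm ⟦ does (rep c ≟ᶜ s) ⟧ ⟦ onOrbit s ⟧)
                              (sym (*-distribˡ-∑ᶜ ⟦ onOrbit s ⟧ (λ c → ⟦ does (rep c ≟ᶜ s) ⟧)))) ⟩
    ∑ᶜ (λ s → ⟦ onOrbit s ⟧ * ∑ᶜ (λ c → ⟦ does (rep c ≟ᶜ s) ⟧))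
      ≡⟨ ∑ᶜ-cong orbit-weight ⟩
    ∑ᶜ (λ s → q * ⟦ onOrbit s ⟧)
      ≡⟨ *-distribˡ-∑ᶜ q (⟦_⟧ ∘ onOrbit) ⟨
    q * orbitsOfSize q ∎
    where
    open ≡-Reasoning
    onOrbit : Cell n → Bool
    onOrbit s = isRep s ∧ (period s ≡ᵇ q)
    onOrbit-rep : ∀ c → onOrbit (rep c) ≡ (period c ≡ᵇ q)
    onOrbit-rep c = cong₂ _∧_ (dec-true (rep (rep c) ≟ᶜ rep c) (rep-idem c)) (cong (_≡ᵇ q) (period-rep c))
    orbit-weight : ∀ s → ⟦ onOrbit s ⟧ * ∑ᶜ (λ c → ⟦ does (rep c ≟ᶜ s) ⟧) ≡ q * ⟦ onOrbit s ⟧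
    orbit-weight s with rep s ≟ᶜ s | period s ≡ᵇ q in p≡ᵇq
    ... | no  _     | _     = sym (*-zeroʳ q)
    ... | yes _     | false = sym (*-zeroʳ q)
    ... | yes rep-s | true  = begin
      ∑ᶜ (λ c → ⟦ does (rep c ≟ᶜ s) ⟧) + 0  ≡⟨ +-identityʳ _ ⟩
      ∑ᶜ (λ c → ⟦ does (rep c ≟ᶜ s) ⟧)      ≡⟨ orbit-size s rep-s ⟩
      period s                              ≡⟨ ≡ᵇ⇒≡ (period s) q (subst T (sym p≡ᵇq) _) ⟩
      q                                     ≡⟨ *-identityʳ q ⟨
      q * 1                                 ∎

  fixedCells : ℕ
  fixedCells = countᶜ (λ c → does (σ c ≟ᶜ c))

  fixedCells² : ℕ
  fixedCells² = countᶜ (λ c → does (σ (σ c) ≟ᶜ c))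

  period-indicators : ∀ c → ⟦ does (σ c ≟ᶜ c) ⟧ ≡ ⟦ period c ≡ᵇ 1 ⟧
                          × ⟦ does (σ (σ c) ≟ᶜ c) ⟧ ≡ ⟦ period c ≡ᵇ 1 ⟧ + ⟦ period c ≡ᵇ 2 ⟧
                          × 1 ≡ ⟦ does (σ (σ c) ≟ᶜ c) ⟧ + ⟦ period c ≡ᵇ 4 ⟧
  period-indicators c with σ c ≟ᶜ c | σ (σ c) ≟ᶜ c
  ... | yes σc≡c | no σ²c≢c = ⊥-elim (σ²c≢c (trans (cong σ σc≡c) σc≡c))
  ... | yes _    | yes _    = refl , refl , refl
  ... | no  _    | yes _    = refl , refl , refl
  ... | no  _    | no  _    = refl , refl , refl

  orbitsOfSize-1 : orbitsOfSize 1 ≡ fixedCells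
  orbitsOfSize-1 = begin
    orbitsOfSize 1                      ≡⟨ +-identityʳ (orbitsOfSize 1) ⟨
    1 * orbitsOfSize 1                  ≡⟨ cells-of-period 1 ⟨
    countᶜ (λ c → period c ≡ᵇ 1)  ≡⟨ ∑ᶜ-cong (λ c → sym (proj₁ (period-indicators c))) ⟩
    fixedCells                    ∎
    where open ≡-Reasoning

  orbitsOfSize-2 : orbitsOfSize 2 ≡ (fixedCells² ∸ fixedCells) / 2
  orbitsOfSize-2 = sym (exact-quotient 2 {fixedCells} {orbitsOfSize 2} (begin
    fixedCells²
      ≡⟨ ∑ᶜ-cong (λ c → proj₁ (proj₂ (period-indicators c))) ⟩
    ∑ᶜ (λ c → ⟦ period c ≡ᵇ 1 ⟧ + ⟦ period c ≡ᵇ 2 ⟧)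
      ≡⟨ ∑ᶜ-distrib-+ (λ c → ⟦ period c ≡ᵇ 1 ⟧) (λ c → ⟦ period c ≡ᵇ 2 ⟧) ⟩
    countᶜ (λ c → period c ≡ᵇ 1) + countᶜ (λ c → period c ≡ᵇ 2)
      ≡⟨ cong₂ _+_ (∑ᶜ-cong (λ c → sym (proj₁ (period-indicators c)))) (cells-of-period 2) ⟩
    fixedCells + 2 * orbitsOfSize 2 ∎))
    where open ≡-Reasoning

  orbitsOfSize-4 : orbitsOfSize 4 ≡ (n * n ∸ fixedCells²) / 4
  orbitsOfSize-4 = sym (exact-quotient 4 {fixedCells²} {orbitsOfSize 4} (begin
    n * n
      ≡⟨ cong (n *_) (*-identityʳ n) ⟨
    n * (n * 1)
      ≡⟨ ∑ᶜ-const {n} 1 ⟨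
    ∑ᶜ {n} (λ _ → 1)
      ≡⟨ ∑ᶜ-cong (λ c → proj₂ (proj₂ (period-indicators c))) ⟩
    ∑ᶜ (λ c → ⟦ does (σ (σ c) ≟ᶜ c) ⟧ + ⟦ period c ≡ᵇ 4 ⟧)
      ≡⟨ ∑ᶜ-distrib-+ (λ c → ⟦ does (σ (σ c) ≟ᶜ c) ⟧) (λ c → ⟦ period c ≡ᵇ 4 ⟧) ⟩
    fixedCells² + countᶜ (λ c → period c ≡ᵇ 4)
      ≡⟨ cong (fixedCells² +_) (cells-of-period 4) ⟩
    fixedCells² + 4 * orbitsOfSize 4 ∎))
    where open ≡-Reasoning

module Colourings {n : ℕ} (σ : Cell n → Cell n) (σ⁴ : ∀ c → σ ^[ 4 ] c ≡ c)
                  {k : ℕ} (A : Fin k → Fin k) (A⁴ : ∀ v → A ^[ 4 ] v ≡ v) where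

  open Orbits σ σ⁴ public

  fixedTiles : ℕ → ℕ
  fixedTiles q = count (λ v → does (A ^[ q ] v ≟ v))

  weight : Cell n → ℕ
  weight c with rep c ≟ᶜ c
  ... | yes _ = fixedTiles (period c)
  ... | no  _ = 1

  -- τ commutes with σ iff its value at each representative s is fixed by A ^[ period s ] and its value at
  -- every other cell c is determined by the representative; both constraints only look at earlier cells.
  admissible : Cell n → (Cell n → Fin k) → Fin k → Bool
  admissible c τ v with rep c ≟ᶜ c
  ... | yes _ = does (A ^[ period c ] v ≟ v)
  ... | no  _ = does (A ^[ offset c ] (τ (rep c)) ≟ v)

  admissible-causal : Causalᶜ admissible
  admissible-causal c τ τ' agree v with rep c ≟ᶜ c
  ... | yes _     = refl
  ... | no rep≢c = cong (λ w → does (A ^[ offset c ] w ≟ v)) (agree (rep c) (rep-< c rep≢c))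

  admissible-count : ∀ c τ → countᴸ (admissible c τ) (allFin k) ≡ weight c
  admissible-count c τ with rep c ≟ᶜ c
  ... | yes _ = countᴸ-tabulate (λ v → does (A ^[ period c ] v ≟ v)) id
  ... | no  _ = trans (countᴸ-tabulate (λ v → does (A ^[ offset c ] (τ (rep c)) ≟ v)) id)
                      (count-≟ (A ^[ offset c ] (τ (rep c))))

  A^-stable : ∀ s d {v} → A ^[ period s ] v ≡ v → σ ^[ d ] s ≡ s → A ^[ d ] v ≡ v
  A^-stable s d {v} Aᵖv≡v σᵈs≡s = trans (^[%] A Aᵖv≡v d) (cong (λ e → A ^[ e ] v) (period-∣ s d σᵈs≡s))

  A^-consistent : ∀ s a b {v} → A ^[ period s ] v ≡ v → σ ^[ a ] s ≡ σ ^[ b ] s → A ^[ a ] v ≡ A ^[ b ] v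
  A^-consistent s a b {v} Aᵖv≡v σᵃs≡σᵇs = begin
    A ^[ a ] v                        ≡⟨ cong (A ^[ a ]_) (^[*]-fixed A (A⁴ v) b) ⟨
    A ^[ a ] (A ^[ b * 4 ] v)         ≡⟨ ^[+] A a (b * 4) v ⟨
    A ^[ a + b * 4 ] v                ≡⟨ cong (λ e → A ^[ e ] v) (solve 2 (λ a b → b :+ (b :* con 3 :+ a) := a :+ b :* con 4) refl a b) ⟨
    A ^[ b + (b * 3 + a) ] v          ≡⟨ ^[+] A b (b * 3 + a) v ⟩
    A ^[ b ] (A ^[ b * 3 + a ] v)     ≡⟨ cong (A ^[ b ]_) (A^-stable s (b * 3 + a) Aᵖv≡v back-to-s) ⟩
    A ^[ b ] v                        ∎
    where
    open ≡-Reasoning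
    back-to-s : σ ^[ b * 3 + a ] s ≡ s
    back-to-s = begin
      σ ^[ b * 3 + a ] s              ≡⟨ ^[+] σ (b * 3) a s ⟩
      σ ^[ b * 3 ] (σ ^[ a ] s)       ≡⟨ cong (σ ^[ b * 3 ]_) σᵃs≡σᵇs ⟩
      σ ^[ b * 3 ] (σ ^[ b ] s)       ≡⟨ ^[+] σ (b * 3) b s ⟨
      σ ^[ b * 3 + b ] s              ≡⟨ cong (λ e → σ ^[ e ] s) (solve 1 (λ b → b :* con 3 :+ b := b :* con 4) refl b) ⟩
      σ ^[ b * 4 ] s                  ≡⟨ σ^multiple-of-4 b s ⟩
      s                               ∎

  module _ {τ : Cell n → Fin k} where

    equivariant⇒admissible : (∀ c → τ (σ c) ≡ A (τ c)) → ∀ c → T (admissible c τ (τ c))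
    equivariant⇒admissible equivariant c with rep c ≟ᶜ c
    ... | yes _ = T-does⇐ (A ^[ period c ] (τ c) ≟ τ c)
                        (trans (sym (^[]-natural τ equivariant (period c) c)) (cong τ (σ^period c)))
    ... | no  _ = T-does⇐ (A ^[ offset c ] (τ (rep c)) ≟ τ c)
                        (trans (sym (^[]-natural τ equivariant (offset c) (rep c))) (cong τ (σ^offset c)))

    module _ (admissible-τ : ∀ c → T (admissible c τ (τ c))) where

      stable-at-rep : ∀ s → rep s ≡ s → A ^[ period s ] (τ s) ≡ τ s
      stable-at-rep s rep≡s with rep s ≟ᶜ s | admissible-τ s
      ... | yes _    | ok = T-does⇒ (A ^[ period s ] (τ s) ≟ τ s) ok
      ... | no rep≢s | _  = ⊥-elim (rep≢s rep≡s)

      from-rep : ∀ c → A ^[ offset c ] (τ (rep c)) ≡ τ c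
      from-rep c with rep c ≟ᶜ c | admissible-τ c
      ... | no  _     | ok = T-does⇒ (A ^[ offset c ] (τ (rep c)) ≟ τ c) ok
      ... | yes rep≡c | _  = trans (cong (λ z → A ^[ offset c ] (τ z)) rep≡c)
                                   (A^-stable c (offset c) (stable-at-rep c rep≡c)
                                              (subst (λ z → σ ^[ offset c ] z ≡ c) rep≡c (σ^offset c)))

      admissible⇒equivariant : ∀ c → τ (σ c) ≡ A (τ c)
      admissible⇒equivariant c = begin
        τ (σ c)                                    ≡⟨ from-rep (σ c) ⟨
        A ^[ offset (σ c) ] (τ (rep (σ c)))        ≡⟨ cong (λ z → A ^[ offset (σ c) ] (τ z)) (rep-σ c) ⟩
        A ^[ offset (σ c) ] (τ (rep c))            ≡⟨ A^-consistent (rep c) (offset (σ c)) (suc (offset c))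
                                                        (stable-at-rep (rep c) (rep-idem c))
                                                        (trans (cong (σ ^[ offset (σ c) ]_) (sym (rep-σ c)))
                                                               (trans (σ^offset (σ c)) (cong σ (sym (σ^offset c))))) ⟩
        A (A ^[ offset c ] (τ (rep c)))            ≡⟨ cong A (from-rep c) ⟩
        A (τ c)                                    ∎
        where open ≡-Reasoning

  Equivariant : (Cell n → Fin k) → Set
  Equivariant τ = ∀ x y → τ (σ (x , y)) ≡ A (τ (x , y))

  equivariant⇔admissible : ∀ τ → Equivariant τ ⇔ T (allᶜ (λ c → admissible c τ (τ c)))
  equivariant⇔admissible τ = mk⇔
    (λ equivariant → Equivalence.from (T-allᶜ _) (equivariant⇒admissible (λ (x , y) → equivariant x y)))
    (λ ok x y → admissible⇒equivariant (Equivalence.to (T-allᶜ _) ok) (x , y))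

  weight-least : ∀ c → toℕ (rank c) ≡ 0 → weight c ≡ fixedTiles (period c)
  weight-least c rank≡0 with rep c ≟ᶜ c
  ... | yes _    = refl
  ... | no rep≢c = ⊥-elim (rep≢c (rep-least c rank≡0))

  count-equivariant-∏ : Fin k → (E? : ∀ τ → Dec (Equivariant τ)) →
                      length (filter E? (map uncurry (allFuns n (allFuns n (allFin k))))) ≡ ∏ᶜ weight
  count-equivariant-∏ x₀ E? = begin
    length (filter E? (map uncurry tilings))   ≡⟨ length-filter E? (map uncurry tilings) ⟩
    countᴸ (does ∘ E?) (map uncurry tilings)   ≡⟨ countᴸ-map (does ∘ E?) uncurry tilings ⟩
    countᴸ (does ∘ E? ∘ uncurry) tilings       ≡⟨ countᴸ-cong tilings (λ φ → does-⇔ (equivariant⇔admissible (uncurry φ))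
                                                                                    (E? (uncurry φ)) (T? _)) ⟩
    countᴸ (λ φ → allᶜ (λ c → admissible c (uncurry φ) (uncurry φ c))) tilings
                                               ≡⟨ countᴸ-causalᶜ admissible weight admissible-causal admissible-count ⟩
    ∏ᶜ weight                                  ∎
    where
    open ≡-Reasoning
    open CausalChoiceᶜ (allFin k) x₀ n
    tilings : List (Fin n → Fin n → Fin k)
    tilings = allFuns n (allFuns n (allFin k))

  fixedTiles-period : ∀ c → fixedTiles (period c) ≡ fixedTiles 1 ^ ⟦ period c ≡ᵇ 1 ⟧
                                                  * fixedTiles 2 ^ ⟦ period c ≡ᵇ 2 ⟧
                                                  * fixedTiles 4 ^ ⟦ period c ≡ᵇ 4 ⟧
  fixedTiles-period c with σ c ≟ᶜ c | σ (σ c) ≟ᶜ c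
  ... | yes σc≡c | no σ²c≢c = ⊥-elim (σ²c≢c (trans (cong σ σc≡c) σc≡c))
  ... | yes _    | yes _    = solve 1 (λ t → t := t :* con 1 :* con 1 :* con 1) refl (fixedTiles 1)
  ... | no  _    | yes _    = solve 1 (λ t → t := con 1 :* (t :* con 1) :* con 1) refl (fixedTiles 2)
  ... | no  _    | no  _    = solve 1 (λ t → t := con 1 :* con 1 :* (t :* con 1)) refl (fixedTiles 4)

  weight-powers : ∀ c → weight c ≡ fixedTiles 1 ^ ⟦ isRep c ∧ (period c ≡ᵇ 1) ⟧
                                 * fixedTiles 2 ^ ⟦ isRep c ∧ (period c ≡ᵇ 2) ⟧
                                 * fixedTiles 4 ^ ⟦ isRep c ∧ (period c ≡ᵇ 4) ⟧
  weight-powers c with rep c ≟ᶜ c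
  ... | yes _ = fixedTiles-period c
  ... | no  _ = refl

  ∏ᶜ-weight : ∏ᶜ weight ≡ fixedTiles 1 ^ fixedCells * fixedTiles 2 ^ ((fixedCells² ∸ fixedCells) / 2)
                           * k ^ ((n * n ∸ fixedCells²) / 4)
  ∏ᶜ-weight = begin
    ∏ᶜ weight
      ≡⟨ ∏ᶜ-cong weight-powers ⟩
    ∏ᶜ (λ c → t 1 ^ represents 1 c * t 2 ^ represents 2 c * t 4 ^ represents 4 c)
      ≡⟨ ∏ᶜ-distrib-* (λ c → t 1 ^ represents 1 c * t 2 ^ represents 2 c) (λ c → t 4 ^ represents 4 c) ⟩
    ∏ᶜ (λ c → t 1 ^ represents 1 c * t 2 ^ represents 2 c) * ∏ᶜ (λ c → t 4 ^ represents 4 c)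
      ≡⟨ cong (_* ∏ᶜ (λ c → t 4 ^ represents 4 c)) (∏ᶜ-distrib-* (λ c → t 1 ^ represents 1 c) (λ c → t 2 ^ represents 2 c)) ⟩
    ∏ᶜ (λ c → t 1 ^ represents 1 c) * ∏ᶜ (λ c → t 2 ^ represents 2 c) * ∏ᶜ (λ c → t 4 ^ represents 4 c)
      ≡⟨ cong₂ _*_ (cong₂ _*_ (∏ᶜ-^ (t 1) (represents 1)) (∏ᶜ-^ (t 2) (represents 2))) (∏ᶜ-^ (t 4) (represents 4)) ⟩
    t 1 ^ orbitsOfSize 1 * t 2 ^ orbitsOfSize 2 * t 4 ^ orbitsOfSize 4
      ≡⟨ cong₂ _*_ (cong₂ _*_ (cong (t 1 ^_) orbitsOfSize-1) (cong (t 2 ^_) orbitsOfSize-2)) (cong₂ _^_ fixedTiles-4 orbitsOfSize-4) ⟩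
    t 1 ^ fixedCells * t 2 ^ ((fixedCells² ∸ fixedCells) / 2) * k ^ ((n * n ∸ fixedCells²) / 4) ∎
    where
    open ≡-Reasoning
    t : ℕ → ℕ
    t = fixedTiles
    represents : ℕ → Cell n → ℕ
    represents q c = ⟦ isRep c ∧ (period c ≡ᵇ q) ⟧
    fixedTiles-4 : fixedTiles 4 ≡ k
    fixedTiles-4 = trans (count-cong λ v → dec-true (A ^[ 4 ] v ≟ v) (A⁴ v)) (count-true k)

count-equivariant : ∀ {n} (σ : Cell n → Cell n) (σ⁴ : ∀ c → σ ^[ 4 ] c ≡ c)
                      {k} (A : Fin k → Fin k) (A⁴ : ∀ v → A ^[ 4 ] v ≡ v) →
  (E? : ∀ τ → Dec (Colourings.Equivariant σ σ⁴ A A⁴ τ)) →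
  let open Colourings σ σ⁴ A A⁴ in
  length (filter E? (map uncurry (allFuns n (allFuns n (allFin k)))))
    ≡ fixedTiles 1 ^ fixedCells * fixedTiles 2 ^ ((fixedCells² ∸ fixedCells) / 2) * k ^ ((n * n ∸ fixedCells²) / 4)
count-equivariant σ σ⁴ {suc k} A A⁴ E? = trans (C.count-equivariant-∏ fzero E?) C.∏ᶜ-weight
  where module C = Colourings σ σ⁴ A A⁴
-- Without tile designs the causal count has no default value; then either there are no cells or the
-- first cell is a representative whose weight is 0.
count-equivariant {zero} σ σ⁴ {zero} A A⁴ E? =
  trans (length-filter E? (map uncurry (allFuns 0 (allFuns 0 [])))) (cong (λ b → ⟦ b ⟧ + 0) (dec-true (E? _) (λ ())))
count-equivariant {suc m} σ σ⁴ {zero} A A⁴ E? = trans (sym no-colouring) C.∏ᶜ-weight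
  where
  module C = Colourings σ σ⁴ A A⁴
  no-colouring : ∏ᶜ C.weight ≡ 0
  no-colouring = cong (λ w → w * ∏ (λ y → C.weight (fzero , fsuc y)) * ∏ (λ x → ∏ (λ y → C.weight (fsuc x , y))))
                      (C.weight-least (fzero , fzero) refl)

module Swap {n : ℕ} (σ : Cell n → Cell n) (u w : Fin n → Fin n) (σ-swap : ∀ x y → σ (x , y) ≡ (u y , w x)) where

  σ²-swap : ∀ x y → σ (σ (x , y)) ≡ (u (w x) , w (u y))
  σ²-swap x y = trans (cong σ (σ-swap x y)) (σ-swap (u y) (w x))

  σ⁴ : (∀ x → u (w (u (w x))) ≡ x) → (∀ y → w (u (w (u y))) ≡ y) → ∀ c → σ ^[ 4 ] c ≡ c
  σ⁴ uw-involutive wu-involutive (x , y) = begin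
    σ (σ (σ (σ (x , y))))               ≡⟨ cong (σ ∘ σ) (σ²-swap x y) ⟩
    σ (σ (u (w x) , w (u y)))           ≡⟨ σ²-swap (u (w x)) (w (u y)) ⟩
    (u (w (u (w x))) , w (u (w (u y)))) ≡⟨ cong₂ _,_ (uw-involutive x) (wu-involutive y) ⟩
    (x , y)                             ∎
    where open ≡-Reasoning

  fixed-σ : countᶜ (λ c → does (σ c ≟ᶜ c)) ≡ count (λ x → does (u (w x) ≟ x))
  fixed-σ = sum-cong-≗ {n} λ x → trans (sum-cong-≗ {n} (fixed-indicator x)) (∑-δ (w x) (λ _ → ⟦ does (u (w x) ≟ x) ⟧))
    where
    fixed⇔ : ∀ x y → σ (x , y) ≡ (x , y) ⇔ (w x ≡ y × u (w x) ≡ x)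
    fixed⇔ x y = mk⇔ (λ σxy≡xy → let swapped = trans (sym (σ-swap x y)) σxy≡xy in
                                  cong proj₂ swapped , trans (cong (u ∘ proj₂) swapped) (cong proj₁ swapped))
                     (λ (wx≡y , uwx≡x) → trans (σ-swap x y) (cong₂ _,_ (trans (cong u (sym wx≡y)) uwx≡x) wx≡y))
    fixed-indicator : ∀ x y → ⟦ does (σ (x , y) ≟ᶜ (x , y)) ⟧ ≡ ⟦ does (w x ≟ y) ⟧ * ⟦ does (u (w x) ≟ x) ⟧
    fixed-indicator x y = trans (cong ⟦_⟧ (does-⇔ (fixed⇔ x y) (σ (x , y) ≟ᶜ (x , y)) (w x ≟ y ×-dec u (w x) ≟ x)))
                                (⟦∧⟧ (does (w x ≟ y)) (does (u (w x) ≟ x)))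

  fixed-σ² : countᶜ (λ c → does (σ (σ c) ≟ᶜ c)) ≡ count (λ x → does (u (w x) ≟ x)) * count (λ y → does (w (u y) ≟ y))
  fixed-σ² = begin
    ∑[ x < n ] ∑[ y < n ] ⟦ does (σ (σ (x , y)) ≟ᶜ (x , y)) ⟧
      ≡⟨ sum-cong-≗ {n} (λ x → trans (sum-cong-≗ {n} (fixed-indicator x)) (sym (*-distribˡ-sum ⟦ uw-fixed x ⟧ (⟦_⟧ ∘ wu-fixed)))) ⟩
    ∑[ x < n ] (⟦ uw-fixed x ⟧ * count wu-fixed)
      ≡⟨ *-distribʳ-sum (count wu-fixed) (⟦_⟧ ∘ uw-fixed) ⟨
    count uw-fixed * count wu-fixed ∎
    where
    open ≡-Reasoning
    uw-fixed : Fin n → Bool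
    uw-fixed x = does (u (w x) ≟ x)
    wu-fixed : Fin n → Bool
    wu-fixed y = does (w (u y) ≟ y)
    fixed⇔ : ∀ x y → σ (σ (x , y)) ≡ (x , y) ⇔ (u (w x) ≡ x × w (u y) ≡ y)
    fixed⇔ x y = mk⇔ (λ σ²xy≡xy → let swapped = trans (sym (σ²-swap x y)) σ²xy≡xy in cong proj₁ swapped , cong proj₂ swapped)
                     (λ (uwx≡x , wuy≡y) → trans (σ²-swap x y) (cong₂ _,_ uwx≡x wuy≡y))
    fixed-indicator : ∀ x y → ⟦ does (σ (σ (x , y)) ≟ᶜ (x , y)) ⟧ ≡ ⟦ uw-fixed x ⟧ * ⟦ wu-fixed y ⟧
    fixed-indicator x y = trans (cong ⟦_⟧ (does-⇔ (fixed⇔ x y) (σ (σ (x , y)) ≟ᶜ (x , y)) (u (w x) ≟ x ×-dec w (u y) ≟ y)))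
                                (⟦∧⟧ (uw-fixed x) (wu-fixed y))

∑-↑ : ∀ m {n} (f : Fin (m + n) → ℕ) → ∑[ i < m + n ] f i ≡ ∑[ i < m ] f (i ↑ˡ n) + ∑[ j < n ] f (m ↑ʳ j)
∑-↑ zero    f = refl
∑-↑ (suc m) f = trans (cong (f fzero +_) (∑-↑ m (f ∘ fsuc))) (sym (+-assoc (f fzero) _ _))

module Congruence (m : ℕ) where

  N : ℕ
  N = suc m

  infix 4 _≋_ _≋?_

  _≋_ : ℕ → ℕ → Set
  a ≋ b = a % N ≡ b % N

  _≋?_ : ∀ a b → Dec (a ≋ b)
  a ≋? b = a % N ℕ.≟ b % N

  ≋-+ˡ : ∀ c {a b} → a ≋ b → c + a ≋ c + b
  ≋-+ˡ c {a} {b} a≋b = trans (%-distribˡ-+ c a N) (trans (cong (λ z → (c % N + z) % N) a≋b) (sym (%-distribˡ-+ c b N)))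

  ≋-+ʳ : ∀ c {a b} → a ≋ b → a + c ≋ b + c
  ≋-+ʳ c {a} {b} a≋b = trans (cong (_% N) (+-comm a c)) (trans (≋-+ˡ c a≋b) (cong (_% N) (+-comm c b)))

  ≋-*ˡ : ∀ c {a b} → a ≋ b → c * a ≋ c * b
  ≋-*ˡ c {a} {b} a≋b = trans (%-distribˡ-* c a N) (trans (cong (λ z → (c % N * z) % N) a≋b) (sym (%-distribˡ-* c b N)))

  +-*N : ∀ a q → a + q * N ≋ a
  +-*N a q = [m+kn]%n≡m%n a q N

  %-≋ : ∀ a → a % N ≋ a
  %-≋ a = m%n%n≡m%n a N

  ≋-cancelʳ : ∀ c {a b} → a + c ≋ b + c → a ≋ b
  ≋-cancelʳ c {a} {b} eq = begin
    a % N                  ≡⟨ +-*N a c ⟨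
    (a + c * N) % N        ≡⟨ cong (_% N) (shift a) ⟩
    (a + c + c * m) % N    ≡⟨ ≋-+ʳ (c * m) {a + c} {b + c} eq ⟩
    (b + c + c * m) % N    ≡⟨ cong (_% N) (shift b) ⟨
    (b + c * N) % N        ≡⟨ +-*N b c ⟩
    b % N                  ∎
    where
    open ≡-Reasoning
    shift : ∀ a → a + c * N ≡ a + c + c * m
    shift a = solve 3 (λ a c m → a :+ c :* (con 1 :+ m) := a :+ c :+ c :* m) refl a c m

  ≋⇒≡ : ∀ {a b} → a < N → b < N → a ≋ b → a ≡ b
  ≋⇒≡ a<N b<N a≋b = trans (sym (m<n⇒m%n≡m a<N)) (trans a≋b (m<n⇒m%n≡m b<N))

  unique-residue : ∀ s t → count (λ (x : Fin N) → does (toℕ x + s ≋? t)) ≡ 1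
  unique-residue s t = count-unique (λ x → toℕ x + s ≋? t) (yes tt) (λ _ → x₀ , x₀+s≋t) (λ _ _ → tt)
    (λ x y x+s≋t y+s≋t → toℕ-injective (≋⇒≡ (toℕ<n x) (toℕ<n y) (≋-cancelʳ s {toℕ x} {toℕ y} (trans x+s≋t (sym y+s≋t)))))
    where
    x₀ : Fin N
    x₀ = fromℕ< (m%n<n (t + m * s) N)
    x₀+s≋t : toℕ x₀ + s ≋ t
    x₀+s≋t = begin
      (toℕ x₀ + s) % N           ≡⟨ cong (λ z → (z + s) % N) (toℕ-fromℕ< (m%n<n (t + m * s) N)) ⟩
      ((t + m * s) % N + s) % N  ≡⟨ ≋-+ʳ s {(t + m * s) % N} {t + m * s} (%-≋ (t + m * s)) ⟩
      (t + m * s + s) % N        ≡⟨ cong (_% N) (solve 3 (λ t m s → t :+ m :* s :+ s := t :+ s :* (con 1 :+ m)) refl t m s) ⟩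
      (t + s * N) % N            ≡⟨ +-*N t s ⟩
      t % N                      ∎
      where open ≡-Reasoning

  count-residues : ∀ K s t → count {K * N} (λ x → does (toℕ x + s ≋? t)) ≡ K
  count-residues zero    s t = refl
  count-residues (suc K) s t = begin
    count {N + K * N} (λ x → does (toℕ x + s ≋? t))
      ≡⟨ ∑-↑ N (λ x → ⟦ does (toℕ x + s ≋? t) ⟧) ⟩
    ∑[ i < N ] ⟦ does (toℕ (i ↑ˡ K * N) + s ≋? t) ⟧ + ∑[ j < K * N ] ⟦ does (toℕ (N ↑ʳ j) + s ≋? t) ⟧
      ≡⟨ cong₂ _+_ (count-cong {N} λ i → cong (λ z → does (z + s ≋? t)) (toℕ-↑ˡ i (K * N)))
                   (count-cong {K * N} λ j → does-⇔ (period-N j) (toℕ (N ↑ʳ j) + s ≋? t) (toℕ j + s ≋? t)) ⟩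
    count {N} (λ i → does (toℕ i + s ≋? t)) + count {K * N} (λ j → does (toℕ j + s ≋? t))
      ≡⟨ cong₂ _+_ (unique-residue s t) (count-residues K s t) ⟩
    suc K ∎
    where
    open ≡-Reasoning
    period-N : ∀ j → toℕ (N ↑ʳ j) + s ≋ t ⇔ toℕ j + s ≋ t
    period-N j = mk⇔ (trans (sym shifted)) (trans shifted)
      where
      shifted : toℕ (N ↑ʳ j) + s ≋ toℕ j + s
      shifted = trans (cong (λ z → (z + s) % N) (trans (toℕ-↑ʳ N j) (+-comm N (toℕ j))))
                      (trans (cong (_% N) (solve 3 (λ j n s → j :+ n :+ s := j :+ s :+ con 1 :* n) refl (toℕ j) N s))
                             (+-*N (toℕ j + s) 1))

  ⊕-≋ : ∀ (x a : Fin N) → toℕ (addMod x a) ≋ toℕ x + toℕ a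
  ⊕-≋ x a = trans (cong (_% N) (toℕ-fromℕ< (m%n<n (toℕ x + toℕ a) N))) (%-≋ (toℕ x + toℕ a))

  #2x+s≡t : ℕ → ℕ → ℕ
  #2x+s≡t s t = count (λ (x : Fin N) → does (toℕ x + (toℕ x + s) ≋? t))

  record IsReflection (ρ : Fin N → Fin N) (s t : ℕ) : Set where
    field
      reflects : ∀ x → toℕ (ρ x) + (toℕ x + s) ≋ t

    unique : ∀ {x z} → toℕ z + (toℕ x + s) ≋ t → ρ x ≡ z
    unique {x} {z} z-reflects = toℕ-injective (≋⇒≡ (toℕ<n (ρ x)) (toℕ<n z)
      (≋-cancelʳ (toℕ x + s) {toℕ (ρ x)} {toℕ z} (trans (reflects x) (sym z-reflects))))

    involutive : ∀ x → ρ (ρ x) ≡ x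
    involutive x = unique (trans (cong (_% N) (solve 3 (λ x y s → x :+ (y :+ s) := y :+ (x :+ s)) refl (toℕ x) (toℕ (ρ x)) s))
                                 (reflects x))

    fixedPoints : count (λ x → does (ρ x ≟ x)) ≡ #2x+s≡t s t
    fixedPoints = count-cong λ x → does-⇔
      (mk⇔ (λ ρx≡x → subst (λ z → toℕ z + (toℕ x + s) ≋ t) ρx≡x (reflects x)) unique)
      (ρ x ≟ x) (toℕ x + (toℕ x + s) ≋? t)

  -- For the quarter turn ((a , b) , r), σ² acts on the first coordinate by ρ₁ a b and on the second by ρ₂ a b.
  ρ₁ : Fin N → Fin N → Fin N → Fin N
  ρ₁ a b x = opposite (addMod (addMod x a) b)

  ρ₂ : Fin N → Fin N → Fin N → Fin N
  ρ₂ a b y = addMod (opposite (addMod y b)) a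

  ρ₁-reflection : ∀ a b → IsReflection (ρ₁ a b) (toℕ a + toℕ b) m
  ρ₁-reflection a b .IsReflection.reflects x = begin
    (toℕ (opposite z) + (toℕ x + (toℕ a + toℕ b))) % N
      ≡⟨ cong (λ d → (d + (toℕ x + (toℕ a + toℕ b))) % N) (opposite-prop z) ⟩
    (m ∸ toℕ z + (toℕ x + (toℕ a + toℕ b))) % N
      ≡⟨ ≋-+ˡ (m ∸ toℕ z) {toℕ x + (toℕ a + toℕ b)} {toℕ z} (sym z≋) ⟩
    (m ∸ toℕ z + toℕ z) % N
      ≡⟨ cong (_% N) (m∸n+n≡m (≤-pred (toℕ<n z))) ⟩
    m % N ∎
    where
    open ≡-Reasoning
    z : Fin N
    z = addMod (addMod x a) b
    z≋ : toℕ z ≋ toℕ x + (toℕ a + toℕ b)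
    z≋ = trans (⊕-≋ (addMod x a) b) (trans (≋-+ʳ (toℕ b) {toℕ (addMod x a)} {toℕ x + toℕ a} (⊕-≋ x a))
                                           (cong (_% N) (+-assoc (toℕ x) (toℕ a) (toℕ b))))

  ρ₂-reflection : ∀ a b → IsReflection (ρ₂ a b) (toℕ b) (m + toℕ a)
  ρ₂-reflection a b .IsReflection.reflects y = begin
    (toℕ (addMod (opposite v) a) + (toℕ y + toℕ b)) % N
      ≡⟨ ≋-+ʳ (toℕ y + toℕ b) {toℕ (addMod (opposite v) a)} {toℕ (opposite v) + toℕ a} (⊕-≋ (opposite v) a) ⟩
    (toℕ (opposite v) + toℕ a + (toℕ y + toℕ b)) % N
      ≡⟨ ≋-+ˡ (toℕ (opposite v) + toℕ a) {toℕ y + toℕ b} {toℕ v} (sym (⊕-≋ y b)) ⟩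
    (toℕ (opposite v) + toℕ a + toℕ v) % N
      ≡⟨ cong (λ d → (d + toℕ a + toℕ v) % N) (opposite-prop v) ⟩
    (m ∸ toℕ v + toℕ a + toℕ v) % N
      ≡⟨ cong (_% N) (solve 3 (λ d a v → d :+ a :+ v := d :+ v :+ a) refl (m ∸ toℕ v) (toℕ a) (toℕ v)) ⟩
    (m ∸ toℕ v + toℕ v + toℕ a) % N
      ≡⟨ cong (λ d → (d + toℕ a) % N) (m∸n+n≡m (≤-pred (toℕ<n v))) ⟩
    (m + toℕ a) % N ∎
    where
    open ≡-Reasoning
    v : Fin N
    v = addMod y b

data Parity : ℕ → Set where
  even : ∀ j → Parity (j * 2)
  odd  : ∀ j → Parity (suc (j * 2))

parity : ∀ m → Parity m
parity zero = even 0
parity (suc m) with parity m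
... | even j = odd j
... | odd  j = even (suc j)

parity-≡ : ∀ p → (∃ λ q → p ≡ q * 2) ⊎ (∃ λ q → p ≡ suc (q * 2))
parity-≡ p with parity p
... | even q = inj₁ (q , refl)
... | odd  q = inj₂ (q , refl)

#2x+s≡t-odd : ∀ j s t → Congruence.#2x+s≡t (j * 2) s t ≡ 1
#2x+s≡t-odd j s t =
  trans (count-cong {suc (j * 2)} λ x → does-⇔ (halve (toℕ x)) (toℕ x + (toℕ x + s) ≋? t) (toℕ x + suc j * s ≋? suc j * t))
        (unique-residue (suc j * s) (suc j * t))
  where
  open Congruence (j * 2)
  open ≡-Reasoning
  -- suc j is the inverse of 2 modulo 2j + 1.
  halve : ∀ x → x + (x + s) ≋ t ⇔ x + suc j * s ≋ suc j * t
  halve x = mk⇔ to from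
    where
    to : x + (x + s) ≋ t → x + suc j * s ≋ suc j * t
    to eq = begin
      (x + suc j * s) % N          ≡⟨ +-*N (x + suc j * s) x ⟨
      (x + suc j * s + x * N) % N  ≡⟨ cong (_% N) (solve 3 (λ x j s → x :+ (con 1 :+ j) :* s :+ x :* (con 1 :+ j :* con 2)
                                                              := (con 1 :+ j) :* (x :+ (x :+ s))) refl x j s) ⟩
      (suc j * (x + (x + s))) % N  ≡⟨ ≋-*ˡ (suc j) {x + (x + s)} {t} eq ⟩
      (suc j * t) % N              ∎
    from : x + suc j * s ≋ suc j * t → x + (x + s) ≋ t
    from eq = begin
      (x + (x + s)) % N            ≡⟨ +-*N (x + (x + s)) s ⟨
      (x + (x + s) + s * N) % N    ≡⟨ cong (_% N) (solve 3 (λ x j s → x :+ (x :+ s) :+ s :* (con 1 :+ j :* con 2)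
                                                              := con 2 :* (x :+ (con 1 :+ j) :* s)) refl x j s) ⟩
      (2 * (x + suc j * s)) % N    ≡⟨ ≋-*ˡ 2 {x + suc j * s} {suc j * t} eq ⟩
      (2 * (suc j * t)) % N        ≡⟨ cong (_% N) (solve 2 (λ j t → con 2 :* ((con 1 :+ j) :* t)
                                                              := t :+ t :* (con 1 :+ j :* con 2)) refl j t) ⟩
      (t + t * N) % N              ≡⟨ +-*N t t ⟩
      t % N                        ∎

module _ (h : ℕ) where
  private
    module M = Congruence (suc (h * 2))
    module H = Congruence h
    module P = Congruence 1

  #2x+s≡t≡0 : ∀ s t q → s + t ≡ suc (q * 2) → M.#2x+s≡t s t ≡ 0
  #2x+s≡t≡0 s t q s+t≡odd =
    trans (count-cong {suc h * 2} λ x → dec-false (toℕ x + (toℕ x + s) M.≋? t) (no-solution (toℕ x))) (count-false (suc h * 2))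
    where
    no-solution : ∀ x → ¬ (x + (x + s) M.≋ t)
    no-solution x eq = 0≢1 (begin
      0                       ≡⟨ m*n%n≡0 t 2 ⟨
      (t * 2) % 2             ≡⟨ cong (_% 2) (solve 1 (λ t → t :* con 2 := t :+ t) refl t) ⟩
      (t + t) % 2             ≡⟨ P.≋-+ʳ t {t} {s} (sym s≋t) ⟩
      (s + t) % 2             ≡⟨ cong (_% 2) s+t≡odd ⟩
      suc (q * 2) % 2         ≡⟨ [m+kn]%n≡m%n 1 q 2 ⟩
      1                       ∎)
      where
      open ≡-Reasoning
      0≢1 : 0 ≢ 1
      0≢1 ()
      s≋t : s P.≋ t
      s≋t = begin
        s % 2                   ≡⟨ P.+-*N s x ⟨
        (s + x * 2) % 2         ≡⟨ cong (_% 2) (solve 2 (λ s x → s :+ x :* con 2 := x :+ (x :+ s)) refl s x) ⟩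
        (x + (x + s)) % 2       ≡⟨ m∣n⇒o%n%m≡o%m 2 (suc h * 2) (x + (x + s)) (divides (suc h) refl) ⟨
        (x + (x + s)) % (suc h * 2) % 2 ≡⟨ cong (_% 2) eq ⟩
        t % (suc h * 2) % 2     ≡⟨ m∣n⇒o%n%m≡o%m 2 (suc h * 2) t (divides (suc h) refl) ⟩
        t % 2                   ∎

  -- With s + t = 2q, 2x + s ≡ t modulo 2H iff x + s ≡ q modulo H, which has one solution in each half.
  #2x+s≡t≡2 : ∀ s t q → s + t ≡ q * 2 → M.#2x+s≡t s t ≡ 2
  #2x+s≡t≡2 s t q s+t≡even = begin
    count {suc h * 2} (λ x → does (toℕ x + (toℕ x + s) M.≋? t))
      ≡⟨ count-cong {suc h * 2} (λ x → does-⇔ (halve (toℕ x)) (toℕ x + (toℕ x + s) M.≋? t) (toℕ x + s H.≋? q)) ⟩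
    count {suc h * 2} (λ x → does (toℕ x + s H.≋? q))
      ≡⟨ cong (λ N → count {N} (λ x → does (toℕ x + s H.≋? q))) (*-comm (suc h) 2) ⟩
    count {2 * suc h} (λ x → does (toℕ x + s H.≋? q))
      ≡⟨ H.count-residues 2 s q ⟩
    2 ∎
    where
    open ≡-Reasoning
    doubled : ∀ x → (x + s) % suc h * 2 ≡ (x + (x + s) + s) % (suc h * 2)
    doubled x = trans (m%n*o≡m*o%[n*o] (x + s) (suc h) 2)
                      (cong (_% (suc h * 2)) (solve 2 (λ x s → (x :+ s) :* con 2 := x :+ (x :+ s) :+ s) refl x s))
    q-doubled : q % suc h * 2 ≡ (t + s) % (suc h * 2)
    q-doubled = trans (m%n*o≡m*o%[n*o] q (suc h) 2) (cong (_% (suc h * 2)) (trans (sym s+t≡even) (+-comm s t)))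
    halve : ∀ x → x + (x + s) M.≋ t ⇔ x + s H.≋ q
    halve x = mk⇔ (λ eq → *-cancelʳ-≡ _ _ 2 (trans (doubled x) (trans (M.≋-+ʳ s {x + (x + s)} {t} eq) (sym q-doubled))))
                  (λ eq → M.≋-cancelʳ s {x + (x + s)} {t} (trans (sym (doubled x)) (trans (cong (_* 2) eq) q-doubled)))

  #2x+s≡t-even : ∀ s t → M.#2x+s≡t s t ≡ 2 * (suc (s + t) % 2)
  #2x+s≡t-even s t with parity-≡ (s + t)
  ... | inj₁ (q , s+t≡even) = trans (#2x+s≡t≡2 s t q s+t≡even)
                                    (trans (cong (2 *_) (sym ([m+kn]%n≡m%n 1 q 2))) (cong (λ p → 2 * (suc p % 2)) (sym s+t≡even)))
  ... | inj₂ (q , s+t≡odd)  = trans (#2x+s≡t≡0 s t q s+t≡odd)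
                                    (trans (cong (2 *_) (sym (m*n%n≡0 (suc q) 2))) (cong (λ p → 2 * (suc p % 2)) (sym s+t≡odd)))

#2x+s≡t-cong : ∀ m {s t s' t'} → s + t ≡ s' + t' → Congruence.#2x+s≡t m s t ≡ Congruence.#2x+s≡t m s' t'
#2x+s≡t-cong m {s} {t} {s'} {t'} s+t≡s'+t' with parity m
... | even j = trans (#2x+s≡t-odd j s t) (sym (#2x+s≡t-odd j s' t'))
... | odd  h = trans (#2x+s≡t-even h s t) (trans (cong (λ p → 2 * (suc p % 2)) s+t≡s'+t') (sym (#2x+s≡t-even h s' t')))

∑-periodic₂ : ∀ H (g : ℕ → ℕ) → (∀ p → g (2 + p) ≡ g p) → ∑[ i < H * 2 ] g (toℕ i) ≡ H * (g 0 + g 1)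
∑-periodic₂ zero    g periodic = refl
∑-periodic₂ (suc H) g periodic = begin
  g 0 + (g 1 + ∑[ i < H * 2 ] g (2 + toℕ i))  ≡⟨ cong (λ z → g 0 + (g 1 + z))
                                                      (∑-periodic₂ H (g ∘ (2 +_)) (periodic ∘ (2 +_))) ⟩
  g 0 + (g 1 + H * (g 2 + g 3))              ≡⟨ cong (λ z → g 0 + (g 1 + H * z)) (cong₂ _+_ (periodic 0) (periodic 1)) ⟩
  g 0 + (g 1 + H * (g 0 + g 1))              ≡⟨ +-assoc (g 0) (g 1) _ ⟨
  suc H * (g 0 + g 1)                        ∎
  where open ≡-Reasoning

∑-periodic₂-shifted : ∀ H a (g : ℕ → ℕ) → (∀ p → g (2 + p) ≡ g p) → ∑[ i < H * 2 ] g (a + toℕ i) ≡ H * (g 0 + g 1)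
∑-periodic₂-shifted H a g periodic =
  trans (∑-periodic₂ H (λ p → g (a + p)) (λ p → trans (cong g (shift p)) (periodic (a + p)))) (cong (H *_) (pair a))
  where
  shift : ∀ p → a + (2 + p) ≡ 2 + (a + p)
  shift p = solve 2 (λ a p → a :+ (con 2 :+ p) := con 2 :+ (a :+ p)) refl a p
  pair : ∀ a → g (a + 0) + g (a + 1) ≡ g 0 + g 1
  pair zero                = refl
  pair (suc zero)          = trans (cong (g 1 +_) (periodic 0)) (+-comm (g 1) (g 0))
  pair (suc (suc a))       = trans (cong₂ _+_ (periodic (a + 0)) (periodic (a + 1))) (pair a)

module Rotation (R : Subgroup) (r∈R : T (Subgroup.inR R r)) (TD : TileDesigns R) where

  open TileDesigns TD

  r²∈R : T (Subgroup.inR R r²)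
  r²∈R = Subgroup.mul∈ R r∈R r∈R

  r³∈R : T (Subgroup.inR R r³)
  r³∈R = Subgroup.mul∈ R r²∈R r∈R

  A : Fin k → Fin k
  A d = act d r r∈R

  B : Fin k → Fin k
  B d = act d r³ r³∈R

  A²≡r² : ∀ d → A (A d) ≡ act d r² r²∈R
  A²≡r² d = act-mul d r∈R r∈R

  A³≡B : ∀ d → A (A (A d)) ≡ B d
  A³≡B d = trans (cong A (A²≡r² d)) (act-mul d r²∈R r∈R)

  A⁴ : ∀ d → A ^[ 4 ] d ≡ d
  A⁴ d = trans (cong A (A³≡B d)) (trans (act-mul d r³∈R r∈R) (trans (cong (act d e) (T-irrelevant _ _)) (act-id d)))

  A∘B≡id : ∀ d → A (B d) ≡ d
  A∘B≡id d = trans (cong A (sym (A³≡B d))) (A⁴ d)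

  B²≡A² : ∀ d → B (B d) ≡ A (A d)
  B²≡A² d = begin
    B (B d)                      ≡⟨ A⁴ (B (B d)) ⟨
    A (A (A (A (B (B d)))))      ≡⟨ cong (A ∘ A ∘ A) (A∘B≡id (B d)) ⟩
    A (A (A (B d)))              ≡⟨ cong (A ∘ A) (A∘B≡id d) ⟩
    A (A d)                      ∎
    where open ≡-Reasoning

  B⁴ : ∀ d → B ^[ 4 ] d ≡ d
  B⁴ d = trans (B²≡A² (B (B d))) (trans (cong (A ∘ A) (B²≡A² d)) (A⁴ d))

  B-fixed⇔A-fixed : ∀ d → B d ≡ d ⇔ A d ≡ d
  B-fixed⇔A-fixed d = mk⇔ (λ Bd≡d → trans (cong A (sym Bd≡d)) (A∘B≡id d))
                          (λ Ad≡d → trans (sym (A³≡B d)) (trans (cong (A ∘ A) Ad≡d) (trans (cong A Ad≡d) Ad≡d)))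

  tcount≡count : ∀ g (g∈R : T (Subgroup.inR R g)) → tcount TD g g∈R ≡ count (λ d → does (act d g g∈R ≟ d))
  tcount≡count g g∈R =
    trans (length-filter (λ d → act d g g∈R ≟ d) (allFin k)) (countᴸ-tabulate (λ d → does (act d g g∈R ≟ d)) id)

  -- With F fixed cells there are (F * F - F) / 2 orbits of size 2 and (n * n - F * F) / 4 of size 4.
  fixedTilings : ℕ → ℕ → ℕ
  fixedTilings n F = tcount TD r r∈R ^ F * tcount TD r² r²∈R ^ ((F * F ∸ F) / 2) * k ^ ((n * n ∸ F * F) / 4)

  fixedTilings-≡ : ∀ n {t₁ t₂ F₁ F₂ F} → t₁ ≡ tcount TD r r∈R → t₂ ≡ tcount TD r² r²∈R → F₁ ≡ F → F₂ ≡ F * F →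
                   t₁ ^ F₁ * t₂ ^ ((F₂ ∸ F₁) / 2) * k ^ ((n * n ∸ F₂) / 4) ≡ fixedTilings n F
  fixedTilings-≡ n refl refl refl refl = refl

  module _ {m : ℕ} (a b : Fin (suc m)) where

    open Congruence m

    centres : ℕ
    centres = #2x+s≡t (toℕ a + toℕ b) m

    fixCount-r : fixCount TD a b r r∈R ≡ fixedTilings (suc m) centres
    fixCount-r = trans (count-equivariant σ σ⁴ A A⁴ (fixedBy? TD a b r r∈R))
      (fixedTilings-≡ (suc m) (sym (tcount≡count r r∈R))
                              (trans (count-cong λ d → cong (λ z → does (z ≟ d)) (A²≡r² d)) (sym (tcount≡count r² r²∈R)))
                              (trans σ.fixed-σ uw-fixed) (trans σ.fixed-σ² (cong₂ _*_ uw-fixed wu-fixed)))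
      where
      σ : Cell (suc m) → Cell (suc m)
      σ c = cellActFull c a b r
      module σ = Swap σ (λ y → opposite (addMod y b)) (λ x → addMod x a) (λ x y → refl)
      σ⁴ : ∀ c → σ ^[ 4 ] c ≡ c
      σ⁴ = σ.σ⁴ (IsReflection.involutive (ρ₁-reflection a b)) (IsReflection.involutive (ρ₂-reflection a b))
      uw-fixed : count (λ x → does (ρ₁ a b x ≟ x)) ≡ centres
      uw-fixed = IsReflection.fixedPoints (ρ₁-reflection a b)
      wu-fixed : count (λ y → does (ρ₂ a b y ≟ y)) ≡ centres
      wu-fixed = trans (IsReflection.fixedPoints (ρ₂-reflection a b))
                       (#2x+s≡t-cong m (solve 3 (λ a b m → b :+ (m :+ a) := a :+ b :+ m) refl (toℕ a) (toℕ b) m))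

    fixCount-r³ : fixCount TD a b r³ r³∈R ≡ fixedTilings (suc m) centres
    fixCount-r³ = trans (count-equivariant σ σ⁴ B B⁴ (fixedBy? TD a b r³ r³∈R))
      (fixedTilings-≡ (suc m) (trans (count-cong λ d → does-⇔ (B-fixed⇔A-fixed d) (B d ≟ d) (A d ≟ d)) (sym (tcount≡count r r∈R)))
                              (trans (count-cong λ d → cong (λ z → does (z ≟ d)) (trans (B²≡A² d) (A²≡r² d)))
                                     (sym (tcount≡count r² r²∈R)))
                              (trans σ.fixed-σ uw-fixed) (trans σ.fixed-σ² (cong₂ _*_ uw-fixed wu-fixed)))
      where
      σ : Cell (suc m) → Cell (suc m)
      σ c = cellActFull c a b r³
      module σ = Swap σ (λ y → addMod y b) (λ x → opposite (addMod x a))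
                        (λ x y → cong (_, opposite (addMod x a)) (opposite-involutive (addMod y b)))
      σ⁴ : ∀ c → σ ^[ 4 ] c ≡ c
      σ⁴ = σ.σ⁴ (IsReflection.involutive (ρ₂-reflection b a)) (IsReflection.involutive (ρ₁-reflection b a))
      uw-fixed : count (λ x → does (ρ₂ b a x ≟ x)) ≡ centres
      uw-fixed = trans (IsReflection.fixedPoints (ρ₂-reflection b a))
                       (#2x+s≡t-cong m (solve 3 (λ a b m → a :+ (m :+ b) := a :+ b :+ m) refl (toℕ a) (toℕ b) m))
      wu-fixed : count (λ y → does (ρ₁ b a y ≟ y)) ≡ centres
      wu-fixed = trans (IsReflection.fixedPoints (ρ₁-reflection b a))
                       (#2x+s≡t-cong m (solve 3 (λ a b m → b :+ a :+ m := a :+ b :+ m) refl (toℕ a) (toℕ b) m))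

  FixSq≡∑∑ : ∀ n g (g∈R : T (Subgroup.inR R g)) → FixSq TD g g∈R n ≡ ∑[ a < n ] ∑[ b < n ] fixCount TD a b g g∈R
  FixSq≡∑∑ n g g∈R = trans (sum-map-tabulate (λ a → ListSum.sum (map (λ b → fixCount TD a b g g∈R) (allFin n))) id)
                           (sum-cong-≗ {n} λ a → sum-map-tabulate (λ b → fixCount TD a b g g∈R) id)

  FixSq-r≡r³ : ∀ m → FixSq TD r r∈R (suc m) ≡ FixSq TD r³ r³∈R (suc m)
  FixSq-r≡r³ m = begin
    FixSq TD r r∈R (suc m)                                            ≡⟨ FixSq≡∑∑ (suc m) r r∈R ⟩
    ∑[ a < suc m ] ∑[ b < suc m ] fixCount TD a b r r∈R                ≡⟨ sum-cong-≗ {suc m} (λ a → sum-cong-≗ {suc m} λ b →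
                                                                              trans (fixCount-r a b) (sym (fixCount-r³ a b))) ⟩
    ∑[ a < suc m ] ∑[ b < suc m ] fixCount TD a b r³ r³∈R              ≡⟨ FixSq≡∑∑ (suc m) r³ r³∈R ⟨
    FixSq TD r³ r³∈R (suc m)                                          ∎
    where open ≡-Reasoning

  tcount-e : tcount TD e (Subgroup.id∈ R) ≡ k
  tcount-e = trans (tcount≡count e (Subgroup.id∈ R))
                   (trans (count-cong λ d → dec-true (act d e (Subgroup.id∈ R) ≟ d) (act-id d)) (count-true k))

  ∑∑-const : ∀ n c → ∑[ a < n ] ∑[ b < n ] c ≡ n * (n * c)
  ∑∑-const n c = trans (sum-cong-≗ {n} λ _ → sum-const n c) (sum-const n (n * c))

  FixSq-odd : ∀ j → let n = suc (j * 2) in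
              FixSq TD r r∈R n ≡ n ^ 2 * (tcount TD e (Subgroup.id∈ R) ^ ((n ^ 2 ∸ 1) / 4) * tcount TD r r∈R)
  FixSq-odd j = begin
    FixSq TD r r∈R n                                  ≡⟨ FixSq≡∑∑ n r r∈R ⟩
    ∑[ a < n ] ∑[ b < n ] fixCount TD a b r r∈R        ≡⟨ sum-cong-≗ {n} (λ a → sum-cong-≗ {n} λ b →
                                                            trans (fixCount-r a b) (cong (fixedTilings n) (#2x+s≡t-odd j (toℕ a + toℕ b) (j * 2)))) ⟩
    ∑[ a < n ] ∑[ b < n ] fixedTilings n 1            ≡⟨ ∑∑-const n (fixedTilings n 1) ⟩
    n * (n * fixedTilings n 1)                        ≡⟨ solve 3 (λ n t K → n :* (n :* (t :* con 1 :* con 1 :* K)) := n :* n :* (K :* t))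
                                                               refl n (tcount TD r r∈R) (k ^ ((n * n ∸ 1) / 4)) ⟩
    n * n * (k ^ ((n * n ∸ 1) / 4) * tcount TD r r∈R) ≡⟨ cong₂ (λ n² t → n² * (t ^ ((n² ∸ 1) / 4) * tcount TD r r∈R))
                                                               (sym (cong (n *_) (*-identityʳ n))) (sym tcount-e) ⟩
    n ^ 2 * (tcount TD e (Subgroup.id∈ R) ^ ((n ^ 2 ∸ 1) / 4) * tcount TD r r∈R) ∎
    where
    open ≡-Reasoning
    n : ℕ
    n = suc (j * 2)

  FixSq-even : ∀ h → let n = suc h * 2 in
               2 * FixSq TD r r∈R n ≡ n ^ 2 * (tcount TD e (Subgroup.id∈ R) ^ (n ^ 2 / 4)
                                               + tcount TD e (Subgroup.id∈ R) ^ ((n ^ 2 ∸ 4) / 4) * tcount TD r r∈R ^ 2 * tcount TD r² r²∈R)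
  FixSq-even h = begin
    2 * FixSq TD r r∈R n
      ≡⟨ cong (2 *_) (FixSq≡∑∑ n r r∈R) ⟩
    2 * ∑[ a < n ] ∑[ b < n ] fixCount TD a b r r∈R
      ≡⟨ cong (2 *_) (sum-cong-≗ {n} λ a → sum-cong-≗ {n} λ b →
                        trans (fixCount-r a b) (cong (fixedTilings n) (#2x+s≡t-even h (toℕ a + toℕ b) (suc (h * 2))))) ⟩
    2 * ∑[ a < n ] ∑[ b < n ] g (toℕ a + toℕ b)
      ≡⟨ cong (2 *_) (sum-cong-≗ {n} λ a → ∑-periodic₂-shifted (suc h) (toℕ a) g g-periodic) ⟩
    2 * ∑[ a < n ] (suc h * (g 0 + g 1))
      ≡⟨ cong (2 *_) (sum-const n (suc h * (g 0 + g 1))) ⟩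
    2 * (n * (suc h * (g 0 + g 1)))
      ≡⟨ cong (λ z → 2 * (n * (suc h * z))) (cong₂ _+_ g0 g1) ⟩
    2 * (n * (suc h * (fixedTilings n 0 + fixedTilings n 2)))
      ≡⟨ solve 5 (λ H K₁ K₂ t t₂ → con 2 :* ((H :* con 2) :* (H :* (con 1 :* con 1 :* K₁ :+ t :* (t₂ :* con 1) :* K₂)))
                                  := (H :* con 2) :* (H :* con 2) :* (K₁ :+ K₂ :* t :* t₂))
               refl (suc h) (k ^ (n * n / 4)) (k ^ ((n * n ∸ 4) / 4)) (tcount TD r r∈R ^ 2) (tcount TD r² r²∈R) ⟩
    n * n * (k ^ (n * n / 4) + k ^ ((n * n ∸ 4) / 4) * tcount TD r r∈R ^ 2 * tcount TD r² r²∈R)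
      ≡⟨ cong₂ (λ n² t → n² * (t ^ (n² / 4) + t ^ ((n² ∸ 4) / 4) * tcount TD r r∈R ^ 2 * tcount TD r² r²∈R))
               (sym (cong (n *_) (*-identityʳ n))) (sym tcount-e) ⟩
    n ^ 2 * (tcount TD e (Subgroup.id∈ R) ^ (n ^ 2 / 4)
             + tcount TD e (Subgroup.id∈ R) ^ ((n ^ 2 ∸ 4) / 4) * tcount TD r r∈R ^ 2 * tcount TD r² r²∈R) ∎
    where
    open ≡-Reasoning
    n : ℕ
    n = suc h * 2
    g : ℕ → ℕ
    g p = fixedTilings n (2 * (suc (p + suc (h * 2)) % 2))
    g-periodic : ∀ p → g (2 + p) ≡ g p
    g-periodic p = cong (λ z → fixedTilings n (2 * z))
      (trans (cong (_% 2) (solve 2 (λ p h → con 1 :+ (con 2 :+ p :+ (con 1 :+ h :* con 2))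
                                          := con 1 :+ (p :+ (con 1 :+ h :* con 2)) :+ con 1 :* con 2) refl p h))
             ([m+kn]%n≡m%n (suc (p + suc (h * 2))) 1 2))
    g0 : g 0 ≡ fixedTilings n 0
    g0 = cong (λ z → fixedTilings n (2 * z)) (m*n%n≡0 (suc h) 2)
    g1 : g 1 ≡ fixedTilings n 2
    g1 = cong (λ z → fixedTilings n (2 * z)) ([m+kn]%n≡m%n 1 (suc h) 2)

mainTheorem15 : (n : ℕ) → 1 ≤ n → (R : Subgroup) → (r∈R : T (Subgroup.inR R r)) → (TD : TileDesigns R) →
    let r²∈R = Subgroup.mul∈ R r∈R r∈R
        r³∈R = Subgroup.mul∈ R r²∈R r∈R
        tid = tcount TD e (Subgroup.id∈ R)
        tr = tcount TD r r∈R
        tr² = tcount TD r² r²∈R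
    in (FixSq TD r r∈R n ≡ FixSq TD r³ r³∈R n)
       × (n % 2 ≡ 1 → FixSq TD r r∈R n ≡ n ^ 2 * (tid ^ ((n ^ 2 ∸ 1) / 4) * tr))
       × (n % 2 ≡ 0 → 2 * FixSq TD r r∈R n ≡ n ^ 2 * (tid ^ (n ^ 2 / 4) + tid ^ ((n ^ 2 ∸ 4) / 4) * tr ^ 2 * tr²))
mainTheorem15 (suc m) _ R r∈R TD with parity m
... | even j = FixSq-r≡r³ (j * 2)
             , (λ _ → FixSq-odd j)
             , (λ n%2≡0 → contradiction (trans (sym ([m+kn]%n≡m%n 1 j 2)) n%2≡0) λ ())
  where open Rotation R r∈R TD
... | odd h  = FixSq-r≡r³ (suc (h * 2))
             , (λ n%2≡1 → contradiction (trans (sym (m*n%n≡0 (suc h) 2)) n%2≡1) λ ())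
             , (λ _ → FixSq-even h)
  where open Rotation R r∈R TD
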